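{- Let $K$ be a field, $n\le r$ integers, and $(A_1,A_2,A_3)$ a triple of matrices in $M_n(K)$ such that (i) $\operatorname{Im}[A_1,A_2]$, $\operatorname{Im}[A_1,A_3]$, $\operatorname{Im}[A_2,A_3]$ all have dimension $2(r-n)$, and (ii) $\operatorname{Im}[A_1,A_2]+\operatorname{Im}[A_1,A_3]$, $\operatorname{Im}[A_2,A_1]+\operatorname{Im}[A_2,A_3]$, $\operatorname{Im}[A_3,A_1]+\operatorname{Im}[A_3,A_2]$ all have dimension $3(r-n)$. If $(Z_1,Z_2,Z_3)$ and $(Z'_1,Z'_2,Z'_3)$ are two commuting extensions of size $r$ of $(A_1,A_2,A_3)$ such that $B_1=B'_1$, then $(Z_1,Z_2,Z_3)=(Z'_1,Z'_2,Z'_3)$.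
   Context: $[A,B]=AB-BA$, $\operatorname{Im}A$ is the column space. A tuple $(Z_1,\ldots,Z_p)$ of $r\times r$ matrices over $K$ is a commuting extension of size $r$ of $(A_1,\ldots,A_p)$ ($n\times n$) if the $Z_i$ pairwise commute and $Z_i=\begin{pmatrix} A_i & B_i\\ C_i & D_i\end{pmatrix}$ with $B_i\in M_{n,r-n}(K)$, $C_i\in M_{r-n,n}(K)$, $D_i\in M_{r-n}(K)$; the blocks of $Z'_i$ are denoted $A_i,B'_i,C'_i,D'_i$. -}

module Defs where

open import Level using (Level; _⊔_) renaming (suc to lsuc)
open import Algebra.Bundles using (CommutativeRing)
open import Data.Nat using (ℕ; zero; suc) renaming (_+_ to _+ℕ_)
open import Data.Fin using (Fin; zero; suc; _↑ˡ_; _↑ʳ_)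
open import Data.Product using (Σ; ∃; _×_; _,_)
open import Relation.Nullary using (¬_)

record Field (c ℓ : Level) : Set (lsuc (c ⊔ ℓ)) where
  field
    commutativeRing : CommutativeRing c ℓ
  open CommutativeRing commutativeRing public
  field
    0≉1     : ¬ (0# ≈ 1#)
    inverse : ∀ x → ¬ (x ≈ 0#) → ∃ λ y → x * y ≈ 1#

module LinAlg {c ℓ : Level} (F : Field c ℓ) where
  open Field F using (Carrier; _≈_; _+_; _*_; _-_; 0#)

  Vect : ℕ → Set c
  Vect n = Fin n → Carrier

  Mat : ℕ → ℕ → Set c
  Mat m k = Fin m → Fin k → Carrier

  ∑ : ∀ {n} → (Fin n → Carrier) → Carrier
  ∑ {zero}  f = 0#
  ∑ {suc n} f = f zero + ∑ (λ i → f (suc i))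

  _≈ᵛ_ : ∀ {n} → Vect n → Vect n → Set ℓ
  u ≈ᵛ v = ∀ i → u i ≈ v i

  _+ᵛ_ : ∀ {n} → Vect n → Vect n → Vect n
  (u +ᵛ v) i = u i + v i

  0ᵛ : ∀ {n} → Vect n
  0ᵛ i = 0#

  _≈ᴹ_ : ∀ {m k} → Mat m k → Mat m k → Set ℓ
  M ≈ᴹ N = ∀ i j → M i j ≈ N i j

  _*ᴹ_ : ∀ {a b d} → Mat a b → Mat b d → Mat a d
  (M *ᴹ N) i j = ∑ (λ k → M i k * N k j)

  _-ᴹ_ : ∀ {a b} → Mat a b → Mat a b → Mat a b
  (M -ᴹ N) i j = M i j - N i j

  ⟦_,_⟧ : ∀ {n} → Mat n n → Mat n n → Mat n n
  ⟦ M , N ⟧ = (M *ᴹ N) -ᴹ (N *ᴹ M)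

  _·_ : ∀ {m k} → Mat m k → Vect k → Vect m
  (M · x) i = ∑ (λ j → M i j * x j)

  Subset : ℕ → Set (lsuc (c ⊔ ℓ))
  Subset n = Vect n → Set (c ⊔ ℓ)

  Im : ∀ {m k} → Mat m k → Subset m
  Im M v = ∃ λ x → v ≈ᵛ (M · x)

  _⊕_ : ∀ {n} → Subset n → Subset n → Subset n
  (S ⊕ T) v = ∃ λ s → ∃ λ t → S s × T t × v ≈ᵛ (s +ᵛ t)

  lincomb : ∀ {n k} → (Fin k → Vect n) → (Fin k → Carrier) → Vect n
  lincomb b γ i = ∑ (λ j → γ j * b j i)

  LinIndep : ∀ {n k} → (Fin k → Vect n) → Set (c ⊔ ℓ)
  LinIndep b = ∀ γ → lincomb b γ ≈ᵛ 0ᵛ → ∀ j → γ j ≈ 0#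

  HasDim : ∀ {n} → Subset n → ℕ → Set (c ⊔ ℓ)
  HasDim S d = Σ (Fin d → Vect _) λ b →
                 (∀ j → S (b j)) × LinIndep b × (∀ v → S v → ∃ λ γ → v ≈ᵛ lincomb b γ)

  blockA : ∀ {n m} → Mat (n +ℕ m) (n +ℕ m) → Mat n n
  blockA {n} {m} Z i j = Z (i ↑ˡ m) (j ↑ˡ m)

  blockB : ∀ {n m} → Mat (n +ℕ m) (n +ℕ m) → Mat n m
  blockB {n} {m} Z i j = Z (i ↑ˡ m) (n ↑ʳ j)

  blockC : ∀ {n m} → Mat (n +ℕ m) (n +ℕ m) → Mat m n
  blockC {n} {m} Z i j = Z (n ↑ʳ i) (j ↑ˡ m)

  blockD : ∀ {n m} → Mat (n +ℕ m) (n +ℕ m) → Mat m m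
  blockD {n} {m} Z i j = Z (n ↑ʳ i) (n ↑ʳ j)

  Commute : ∀ {N} → Mat N N → Mat N N → Set ℓ
  Commute X Y = (X *ᴹ Y) ≈ᴹ (Y *ᴹ X)

  IsCommExt : ∀ {n m} → (A₁ A₂ A₃ : Mat n n) → (Z₁ Z₂ Z₃ : Mat (n +ℕ m) (n +ℕ m)) → Set ℓ
  IsCommExt A₁ A₂ A₃ Z₁ Z₂ Z₃ =
    Commute Z₁ Z₂ × Commute Z₁ Z₃ × Commute Z₂ Z₃ ×
    blockA Z₁ ≈ᴹ A₁ × blockA Z₂ ≈ᴹ A₂ × blockA Z₃ ≈ᴹ A₃

module Submission where

-- Comparing top-left blocks in Zᵢ Zⱼ = Zⱼ Zᵢ gives [Aᵢ,Aⱼ] = Bⱼ Cᵢ - Bᵢ Cⱼ, so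
-- Im [Aᵢ,Aⱼ] lies in the span of the 2(r-n) columns of Bⱼ and Bᵢ. By the
-- dimension hypotheses these columns are independent and span exactly
-- Im [Aᵢ,Aⱼ], which does not depend on the extension, and the columns of
-- B₁, B₂, B₃ together are independent. Hence B₂′ lies in
-- span(B₂,B₁) ∩ span(B₃,B₂) = span B₂, i.e. B₂′ = B₂ G₂, and likewise
-- B₃′ = B₃ G₃. Reading the commutator identities in the basis (B₁ ∣ B₂ ∣ B₃)
-- yields C₂ = C₂′, C₃ = C₃′, G₂ C₃ = C₃ and G₃ C₂ = C₂; since C₂ and C₃ are
-- surjective (the same dimension count), G₂ = G₃ = 1. The top-right blocks
-- of the commutation relations then determine the Dᵢ in the same basis.
-- Equality in the field is not decidable, so the dimension count goes
-- through determinants: a square matrix with trivial kernel has a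
-- determinant that cannot vanish, hence an inverse.

open import Defs
open import Level using (Level; _⊔_)
open import Algebra.Bundles using (CommutativeRing)
open import Data.Empty using (⊥; ⊥-elim)
open import Data.Fin as Fin using (Fin; zero; suc; punchIn; punchOut; _↑ˡ_; _↑ʳ_; splitAt)
import Data.Fin.Properties as Fin
open import Data.Integer as ℤ using (ℤ; +_; -[1+_])
import Data.Integer.Properties as ℤ
open import Data.Maybe using (Maybe; just; nothing)
open import Data.Nat as ℕ using (ℕ; zero; suc)
import Data.Nat.Properties as ℕ
open import Data.Product using (Σ; ∃; _×_; _,_; proj₁; proj₂; uncurry)
open import Data.Sign as Sign using (Sign)
open import Data.Sum using ([_,_]′; inj₁; inj₂)
open import Function using (_∘_)
open import Relation.Binary.Bundles using (Setoid)
open import Relation.Binary.PropositionalEquality as ≡ using (_≡_; _≢_)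
import Relation.Binary.Reasoning.Setoid
open import Relation.Nullary using (¬_; yes; no)

-- Algebra.Solver.Ring needs a coefficient ring with a homomorphism into the
-- target; with ℤ as coefficients it proves every commutative-ring identity.
module IntegerCoefficientSolver {c ℓ : Level} (R : CommutativeRing c ℓ) where
  open CommutativeRing R
  open import Algebra.Properties.Semiring.Mult semiring using (×-homo-+; ×1-homo-*) renaming (_×_ to _×ₙ_)
  open import Algebra.Properties.Ring ring using (-‿involutive; -‿distribˡ-*; -‿distribʳ-*; -‿+-comm; -0#≈0#)
  open import Algebra.Solver.Ring.AlmostCommutativeRing
    using (_-Raw-AlmostCommutative⟶_; fromCommutativeRing)
  open import Relation.Binary.Reasoning.Setoid setoid

  private
    ⟦_⟧ℤ : ℤ → Carrier
    ⟦ + n ⟧ℤ      = n ×ₙ 1#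
    ⟦ -[1+ n ] ⟧ℤ = - (suc n ×ₙ 1#)

    ⟦-⟧ℤ : ∀ z → ⟦ ℤ.- z ⟧ℤ ≈ - ⟦ z ⟧ℤ
    ⟦-⟧ℤ (+ zero)  = sym -0#≈0#
    ⟦-⟧ℤ (+ suc n) = refl
    ⟦-⟧ℤ -[1+ n ]  = sym (-‿involutive _)

    ⟦⊖⟧ℤ : ∀ m n → ⟦ m ℤ.⊖ n ⟧ℤ ≈ m ×ₙ 1# - n ×ₙ 1#
    ⟦⊖⟧ℤ m zero = begin
      ⟦ m ℤ.⊖ 0 ⟧ℤ      ≡⟨ ≡.cong ⟦_⟧ℤ (ℤ.⊖-≥ {m} {0} ℕ.z≤n) ⟩
      m ×ₙ 1#           ≈⟨ sym (+-identityʳ _) ⟩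
      m ×ₙ 1# + 0#      ≈⟨ +-congˡ (sym -0#≈0#) ⟩
      m ×ₙ 1# - 0#      ∎
    ⟦⊖⟧ℤ zero (suc n) = begin
      ⟦ 0 ℤ.⊖ suc n ⟧ℤ  ≡⟨ ≡.cong ⟦_⟧ℤ (ℤ.⊖-< {0} {suc n} (ℕ.s≤s ℕ.z≤n)) ⟩
      - (suc n ×ₙ 1#)   ≈⟨ sym (+-identityˡ _) ⟩
      0# - suc n ×ₙ 1#  ∎
    ⟦⊖⟧ℤ (suc m) (suc n) = begin
      ⟦ suc m ℤ.⊖ suc n ⟧ℤ             ≡⟨ ≡.cong ⟦_⟧ℤ (ℤ.[1+m]⊖[1+n]≡m⊖n m n) ⟩
      ⟦ m ℤ.⊖ n ⟧ℤ                     ≈⟨ ⟦⊖⟧ℤ m n ⟩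
      m ×ₙ 1# - n ×ₙ 1#                ≈⟨ -‿cancel-+ˡ 1# (m ×ₙ 1#) (n ×ₙ 1#) ⟩
      (1# + m ×ₙ 1#) - (1# + n ×ₙ 1#)  ∎
      where
      -‿cancel-+ˡ : ∀ x a b → a - b ≈ (x + a) - (x + b)
      -‿cancel-+ˡ x a b = begin
        a - b                  ≈⟨ sym (+-identityˡ _) ⟩
        0# + (a - b)           ≈⟨ +-congʳ (sym (-‿inverseʳ x)) ⟩
        (x - x) + (a - b)      ≈⟨ +-assoc _ _ _ ⟩
        x + (- x + (a - b))    ≈⟨ +-congˡ (sym (+-assoc _ _ _)) ⟩
        x + ((- x + a) - b)    ≈⟨ +-congˡ (+-congʳ (+-comm _ _)) ⟩
        x + ((a - x) - b)      ≈⟨ +-congˡ (+-assoc _ _ _) ⟩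
        x + (a + (- x - b))    ≈⟨ +-congˡ (+-congˡ (-‿+-comm _ _)) ⟩
        x + (a + - (x + b))    ≈⟨ sym (+-assoc _ _ _) ⟩
        (x + a) - (x + b)      ∎

    ⟦+⟧ℤ : ∀ x y → ⟦ x ℤ.+ y ⟧ℤ ≈ ⟦ x ⟧ℤ + ⟦ y ⟧ℤ
    ⟦+⟧ℤ (+ m)      (+ n)      = ×-homo-+ 1# m n
    ⟦+⟧ℤ (+ m)      -[1+ n ]   = ⟦⊖⟧ℤ m (suc n)
    ⟦+⟧ℤ -[1+ m ]   (+ n)      = trans (⟦⊖⟧ℤ n (suc m)) (+-comm _ _)
    ⟦+⟧ℤ -[1+ m ]   -[1+ n ]   = begin
      - (suc (suc (m ℕ.+ n)) ×ₙ 1#)      ≡⟨ ≡.cong (λ k → - (suc k ×ₙ 1#)) (≡.sym (ℕ.+-suc m n)) ⟩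
      - ((suc m ℕ.+ suc n) ×ₙ 1#)        ≈⟨ -‿cong (×-homo-+ 1# (suc m) (suc n)) ⟩
      - (suc m ×ₙ 1# + suc n ×ₙ 1#)      ≈⟨ sym (-‿+-comm _ _) ⟩
      - (suc m ×ₙ 1#) + - (suc n ×ₙ 1#)  ∎

    ⟦_⟧ₛ : Sign → Carrier
    ⟦ Sign.+ ⟧ₛ = 1#
    ⟦ Sign.- ⟧ₛ = - 1#

    ⟦*⟧ₛ : ∀ s t → ⟦ s Sign.* t ⟧ₛ ≈ ⟦ s ⟧ₛ * ⟦ t ⟧ₛ
    ⟦*⟧ₛ Sign.+ t      = sym (*-identityˡ _)
    ⟦*⟧ₛ Sign.- Sign.+ = sym (*-identityʳ _)
    ⟦*⟧ₛ Sign.- Sign.- = begin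
      1#            ≈⟨ sym (-‿involutive _) ⟩
      - - 1#        ≈⟨ -‿cong (sym (*-identityʳ _)) ⟩
      - (- 1# * 1#) ≈⟨ -‿distribʳ-* _ _ ⟩
      - 1# * - 1#   ∎

    ⟦◃⟧ℤ : ∀ s n → ⟦ s ℤ.◃ n ⟧ℤ ≈ ⟦ s ⟧ₛ * (n ×ₙ 1#)
    ⟦◃⟧ℤ Sign.- zero    = sym (zeroʳ _)
    ⟦◃⟧ℤ Sign.+ zero    = sym (zeroʳ _)
    ⟦◃⟧ℤ Sign.+ (suc n) = sym (*-identityˡ _)
    ⟦◃⟧ℤ Sign.- (suc n) = trans (-‿cong (sym (*-identityˡ _))) (-‿distribˡ-* _ _)

    ⟦⟧ℤ-sign-abs : ∀ z → ⟦ z ⟧ℤ ≈ ⟦ ℤ.sign z ⟧ₛ * (ℤ.∣ z ∣ ×ₙ 1#)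
    ⟦⟧ℤ-sign-abs (+ n)    = sym (*-identityˡ _)
    ⟦⟧ℤ-sign-abs -[1+ n ] = trans (-‿cong (sym (*-identityˡ _))) (-‿distribˡ-* _ _)

    ⟦*⟧ℤ : ∀ x y → ⟦ x ℤ.* y ⟧ℤ ≈ ⟦ x ⟧ℤ * ⟦ y ⟧ℤ
    ⟦*⟧ℤ x y = begin
      ⟦ x ℤ.* y ⟧ℤ                ≈⟨ ⟦◃⟧ℤ (ℤ.sign x Sign.* ℤ.sign y) (ℤ.∣ x ∣ ℕ.* ℤ.∣ y ∣) ⟩
      ⟦ ℤ.sign x Sign.* ℤ.sign y ⟧ₛ * ((ℤ.∣ x ∣ ℕ.* ℤ.∣ y ∣) ×ₙ 1#)
                                  ≈⟨ *-cong (⟦*⟧ₛ (ℤ.sign x) (ℤ.sign y)) (×1-homo-* ℤ.∣ x ∣ ℤ.∣ y ∣) ⟩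
      (sx * sy) * (ax * ay)       ≈⟨ *-assoc _ _ _ ⟩
      sx * (sy * (ax * ay))       ≈⟨ *-congˡ (sym (*-assoc _ _ _)) ⟩
      sx * ((sy * ax) * ay)       ≈⟨ *-congˡ (*-congʳ (*-comm _ _)) ⟩
      sx * ((ax * sy) * ay)       ≈⟨ *-congˡ (*-assoc _ _ _) ⟩
      sx * (ax * (sy * ay))       ≈⟨ sym (*-assoc _ _ _) ⟩
      (sx * ax) * (sy * ay)       ≈⟨ sym (*-cong (⟦⟧ℤ-sign-abs x) (⟦⟧ℤ-sign-abs y)) ⟩
      ⟦ x ⟧ℤ * ⟦ y ⟧ℤ             ∎
      where
      sx = ⟦ ℤ.sign x ⟧ₛ
      sy = ⟦ ℤ.sign y ⟧ₛ
      ax = ℤ.∣ x ∣ ×ₙ 1#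
      ay = ℤ.∣ y ∣ ×ₙ 1#

    ⟦⟧ℤ-homomorphism : ℤ.+-*-rawRing -Raw-AlmostCommutative⟶ fromCommutativeRing R
    ⟦⟧ℤ-homomorphism = record
      { ⟦_⟧    = ⟦_⟧ℤ
      ; +-homo = ⟦+⟧ℤ
      ; *-homo = ⟦*⟧ℤ
      ; -‿homo = ⟦-⟧ℤ
      ; 0-homo = refl
      ; 1-homo = +-identityʳ _
      }

    ⟦⟧ℤ-weaklyDecidable : ∀ x y → Maybe (⟦ x ⟧ℤ ≈ ⟦ y ⟧ℤ)
    ⟦⟧ℤ-weaklyDecidable x y with x ℤ.≟ y
    ... | yes ≡.refl = just refl
    ... | no _       = nothing

  open import Algebra.Solver.Ring ℤ.+-*-rawRing (fromCommutativeRing R)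
    ⟦⟧ℤ-homomorphism ⟦⟧ℤ-weaklyDecidable public

module LinearAlgebra {c ℓ : Level} (F : Field c ℓ) where
  open Field F hiding (zero)
  open LinAlg F
  open IntegerCoefficientSolver commutativeRing using (solve; _:=_; _:+_; _:*_; :-_; _:-_; con)
  open import Algebra.Properties.Ring ring using (-‿involutive; -‿distribˡ-*; -‿distribʳ-*; -‿+-comm; -0#≈0#)
  open import Relation.Binary.Reasoning.Setoid setoid

  ∑-cong : ∀ {n} {f g : Fin n → Carrier} → (∀ i → f i ≈ g i) → ∑ f ≈ ∑ g
  ∑-cong {zero}  f≈g = refl
  ∑-cong {suc n} f≈g = +-cong (f≈g zero) (∑-cong (λ i → f≈g (suc i)))

  ∑-zero : ∀ {n} (f : Fin n → Carrier) → (∀ i → f i ≈ 0#) → ∑ f ≈ 0#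
  ∑-zero {zero}  f f≈0 = refl
  ∑-zero {suc n} f f≈0 = trans (+-cong (f≈0 zero) (∑-zero (λ i → f (suc i)) (λ i → f≈0 (suc i)))) (+-identityʳ _)

  ∑-distrib-+ : ∀ {n} (f g : Fin n → Carrier) → ∑ (λ i → f i + g i) ≈ ∑ f + ∑ g
  ∑-distrib-+ {zero}  f g = sym (+-identityʳ _)
  ∑-distrib-+ {suc n} f g = trans (+-congˡ (∑-distrib-+ (λ i → f (suc i)) (λ i → g (suc i))))
    (solve 4 (λ a b c d → (a :+ b) :+ (c :+ d) := (a :+ c) :+ (b :+ d)) refl
      (f zero) (g zero) (∑ (λ i → f (suc i))) (∑ (λ i → g (suc i))))

  *-distribˡ-∑ : ∀ {n} x (f : Fin n → Carrier) → x * ∑ f ≈ ∑ (λ i → x * f i)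
  *-distribˡ-∑ {zero}  x f = zeroʳ x
  *-distribˡ-∑ {suc n} x f = trans (distribˡ _ _ _) (+-congˡ (*-distribˡ-∑ x (λ i → f (suc i))))

  ∑-neg : ∀ {n} (f : Fin n → Carrier) → ∑ (λ i → - f i) ≈ - ∑ f
  ∑-neg {zero}  f = sym -0#≈0#
  ∑-neg {suc n} f = trans (+-congˡ (∑-neg (λ i → f (suc i)))) (-‿+-comm _ _)

  ∑-comm : ∀ {n m} (f : Fin n → Fin m → Carrier) → ∑ (λ i → ∑ (λ j → f i j)) ≈ ∑ (λ j → ∑ (λ i → f i j))
  ∑-comm {zero}  {m} f = sym (∑-zero {m} (λ j → 0#) (λ j → refl))
  ∑-comm {suc n} {m} f = begin
    ∑ (λ j → f zero j) + ∑ (λ i → ∑ (λ j → f (suc i) j)) ≈⟨ +-congˡ (∑-comm (λ i j → f (suc i) j)) ⟩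
    ∑ (λ j → f zero j) + ∑ (λ j → ∑ (λ i → f (suc i) j)) ≈⟨ ∑-distrib-+ (λ j → f zero j) (λ j → ∑ (λ i → f (suc i) j)) ⟨
    ∑ (λ j → f zero j + ∑ (λ i → f (suc i) j))           ∎

  ∑-splitAt : ∀ {a b} (f : Fin (a ℕ.+ b) → Carrier) → ∑ f ≈ ∑ (λ i → f (i ↑ˡ b)) + ∑ (λ j → f (a ↑ʳ j))
  ∑-splitAt {zero}      f = sym (+-identityˡ _)
  ∑-splitAt {suc a} {b} f = trans (+-congˡ (∑-splitAt {a} {b} (λ i → f (suc i)))) (sym (+-assoc _ _ _))

  1ᴹ : ∀ {k} → Mat k k
  1ᴹ i j with i Fin.≟ j
  ... | yes _ = 1#
  ... | no  _ = 0#

  ∑-*-1ᴹ : ∀ {n} (f : Fin n → Carrier) (j : Fin n) → ∑ (λ l → f l * 1ᴹ l j) ≈ f j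
  ∑-*-1ᴹ {suc n} f zero = begin
    f zero * 1# + ∑ (λ l → f (suc l) * 1ᴹ (suc l) zero) ≈⟨ +-cong (*-identityʳ _) (∑-zero (λ l → f (suc l) * 1ᴹ (suc l) zero) (λ l → zeroʳ _)) ⟩
    f zero + 0#                                        ≈⟨ +-identityʳ _ ⟩
    f zero                                             ∎
  ∑-*-1ᴹ {suc n} f (suc j) = begin
    f zero * 0# + ∑ (λ l → f (suc l) * 1ᴹ (suc l) (suc j)) ≈⟨ +-cong (zeroʳ _) (∑-cong {n} (λ l → *-congˡ (1ᴹ-suc l))) ⟩
    0# + ∑ (λ l → f (suc l) * 1ᴹ l j)                     ≈⟨ +-identityˡ _ ⟩
    ∑ (λ l → f (suc l) * 1ᴹ l j)                          ≈⟨ ∑-*-1ᴹ (λ l → f (suc l)) j ⟩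
    f (suc j)                                             ∎
    where
    1ᴹ-suc : ∀ l → 1ᴹ (suc l) (suc j) ≈ 1ᴹ l j
    1ᴹ-suc l with l Fin.≟ j
    ... | yes ≡.refl = refl
    ... | no  _      = refl

  1ᴹ-sym : ∀ {k} (i j : Fin k) → 1ᴹ i j ≈ 1ᴹ j i
  1ᴹ-sym i j with i Fin.≟ j | j Fin.≟ i
  ... | yes _   | yes _   = refl
  ... | no  _   | no  _   = refl
  ... | yes i≡j | no  j≢i = ⊥-elim (j≢i (≡.sym i≡j))
  ... | no  i≢j | yes j≡i = ⊥-elim (i≢j (≡.sym j≡i))

  altsum : ∀ {k} → (Fin k → Carrier) → Carrier
  altsum {zero}  f = 0#
  altsum {suc k} f = f zero - altsum (λ i → f (suc i))

  sign : ∀ {k} → Fin k → Carrier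
  sign zero    = 1#
  sign (suc i) = - sign i

  sign²≈1 : ∀ {k} (i : Fin k) → sign i * sign i ≈ 1#
  sign²≈1 zero    = *-identityʳ _
  sign²≈1 (suc i) = trans (solve 1 (λ s → (:- s) :* (:- s) := s :* s) refl (sign i)) (sign²≈1 i)

  altsum≈∑-sign : ∀ {k} (f : Fin k → Carrier) → altsum f ≈ ∑ (λ i → sign i * f i)
  altsum≈∑-sign {zero}  f = refl
  altsum≈∑-sign {suc k} f = begin
    f zero - altsum (λ i → f (suc i))               ≈⟨ +-cong (sym (*-identityˡ _)) (-‿cong (altsum≈∑-sign (λ i → f (suc i)))) ⟩
    1# * f zero - ∑ (λ i → sign i * f (suc i))      ≈⟨ +-congˡ (∑-neg (λ i → sign i * f (suc i))) ⟨
    1# * f zero + ∑ (λ i → - (sign i * f (suc i)))  ≈⟨ +-congˡ (∑-cong {k} (λ i → -‿distribˡ-* _ _)) ⟩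
    1# * f zero + ∑ (λ i → - sign i * f (suc i))    ∎

  altsum-cong : ∀ {k} {f g : Fin k → Carrier} → (∀ i → f i ≈ g i) → altsum f ≈ altsum g
  altsum-cong {zero}  f≈g = refl
  altsum-cong {suc k} f≈g = +-cong (f≈g zero) (-‿cong (altsum-cong (λ i → f≈g (suc i))))

  altsum-distrib-+ : ∀ {k} (f g : Fin k → Carrier) → altsum (λ i → f i + g i) ≈ altsum f + altsum g
  altsum-distrib-+ {zero}  f g = sym (+-identityʳ _)
  altsum-distrib-+ {suc k} f g = trans (+-congˡ (-‿cong (altsum-distrib-+ (λ i → f (suc i)) (λ i → g (suc i)))))
    (solve 4 (λ a b c d → (a :+ b) :- (c :+ d) := (a :- c) :+ (b :- d)) refl
      (f zero) (g zero) (altsum (λ i → f (suc i))) (altsum (λ i → g (suc i))))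

  *-distribˡ-altsum : ∀ {k} x (f : Fin k → Carrier) → x * altsum f ≈ altsum (λ i → x * f i)
  *-distribˡ-altsum {zero}  x f = zeroʳ x
  *-distribˡ-altsum {suc k} x f =
    trans (solve 3 (λ x a b → x :* (a :- b) := x :* a :- x :* b) refl x (f zero) (altsum (λ i → f (suc i))))
          (+-congˡ (-‿cong (*-distribˡ-altsum x (λ i → f (suc i)))))

  altsum-zero : ∀ {k} (f : Fin k → Carrier) → (∀ i → f i ≈ 0#) → altsum f ≈ 0#
  altsum-zero f f≈0 = trans (altsum≈∑-sign f) (∑-zero (λ i → sign i * f i) (λ i → trans (*-congˡ (f≈0 i)) (zeroʳ _)))

  altsum-comm : ∀ {n m} (f : Fin n → Fin m → Carrier) →
                altsum (λ i → altsum (λ j → f i j)) ≈ altsum (λ j → altsum (λ i → f i j))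
  altsum-comm {n} {m} f = begin
    altsum (λ i → altsum (λ j → f i j))              ≈⟨ altsum≈∑-sign (λ i → altsum (λ j → f i j)) ⟩
    ∑ (λ i → sign i * altsum (λ j → f i j))          ≈⟨ ∑-cong {n} (λ i → *-congˡ (altsum≈∑-sign (λ j → f i j))) ⟩
    ∑ (λ i → sign i * ∑ (λ j → sign j * f i j))      ≈⟨ ∑-cong {n} (λ i → *-distribˡ-∑ (sign i) (λ j → sign j * f i j)) ⟩
    ∑ (λ i → ∑ (λ j → sign i * (sign j * f i j)))    ≈⟨ ∑-comm (λ i j → sign i * (sign j * f i j)) ⟩
    ∑ (λ j → ∑ (λ i → sign i * (sign j * f i j)))    ≈⟨ ∑-cong {m} (λ j → ∑-cong {n} (λ i → x[yz]≈y[xz] (sign i) (sign j) (f i j))) ⟩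
    ∑ (λ j → ∑ (λ i → sign j * (sign i * f i j)))    ≈⟨ ∑-cong {m} (λ j → *-distribˡ-∑ (sign j) (λ i → sign i * f i j)) ⟨
    ∑ (λ j → sign j * ∑ (λ i → sign i * f i j))      ≈⟨ ∑-cong {m} (λ j → *-congˡ (altsum≈∑-sign (λ i → f i j))) ⟨
    ∑ (λ j → sign j * altsum (λ i → f i j))          ≈⟨ altsum≈∑-sign (λ j → altsum (λ i → f i j)) ⟨
    altsum (λ j → altsum (λ i → f i j))              ∎
    where
    x[yz]≈y[xz] : ∀ x y z → x * (y * z) ≈ y * (x * z)
    x[yz]≈y[xz] = solve 3 (λ x y z → x :* (y :* z) := y :* (x :* z)) refl

  altsum-single : ∀ {k} (f : Fin k → Carrier) (i : Fin k) → (∀ l → l ≢ i → f l ≈ 0#) → altsum f ≈ sign i * f i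
  altsum-single {k} f i f≈0 = trans (altsum≈∑-sign f) (trans (∑-cong {k} supported) (∑-*-1ᴹ (λ l → sign l * f l) i))
    where
    supported : ∀ l → sign l * f l ≈ (sign l * f l) * 1ᴹ l i
    supported l with l Fin.≟ i
    ... | yes ≡.refl = sym (*-identityʳ _)
    ... | no  l≢i    = trans (trans (*-congˡ (f≈0 l l≢i)) (zeroʳ _)) (sym (zeroʳ _))

  -- Determinants

  minor : ∀ {k} → Fin (suc k) → Mat (suc k) (suc k) → Mat k k
  minor l M a b = M (suc a) (punchIn l b)

  det : ∀ {k} → Mat k k → Carrier
  det {zero}  M = 1#
  det {suc k} M = altsum (λ l → M zero l * det (minor l M))

  det-cong : ∀ {k} {M N : Mat k k} → M ≈ᴹ N → det M ≈ det N
  det-cong {zero}  M≈N = refl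
  det-cong {suc k} M≈N = altsum-cong (λ l → *-cong (M≈N zero l) (det-cong (λ a b → M≈N (suc a) (punchIn l b))))

  _ᵀ : ∀ {a b} → Mat a b → Mat b a
  (M ᵀ) i j = M j i

  private
    DetᵀInvariant : ℕ → Set _
    DetᵀInvariant k = ∀ (M : Mat k k) → det M ≈ det (M ᵀ)

    altsum-altsum-swap : ∀ {k} (p q : Fin k → Carrier) (G : Fin k → Fin k → Carrier) →
      altsum (λ a → p a * altsum (λ b → q b * G b a)) ≈ altsum (λ a → q a * altsum (λ b → p b * G a b))
    altsum-altsum-swap p q G = begin
      altsum (λ a → p a * altsum (λ b → q b * G b a))   ≈⟨ altsum-cong (λ a → *-distribˡ-altsum (p a) (λ b → q b * G b a)) ⟩
      altsum (λ a → altsum (λ b → p a * (q b * G b a))) ≈⟨ altsum-comm (λ a b → p a * (q b * G b a)) ⟩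
      altsum (λ b → altsum (λ a → p a * (q b * G b a))) ≈⟨ altsum-cong (λ b → altsum-cong (λ a → x[yz]≈y[xz] (p a) (q b) (G b a))) ⟩
      altsum (λ b → altsum (λ a → q b * (p a * G b a))) ≈⟨ altsum-cong (λ b → *-distribˡ-altsum (q b) (λ a → p a * G b a)) ⟨
      altsum (λ a → q a * altsum (λ b → p b * G a b))   ∎
      where
      x[yz]≈y[xz] : ∀ x y z → x * (y * z) ≈ y * (x * z)
      x[yz]≈y[xz] = solve 3 (λ x y z → x :* (y :* z) := y :* (x :* z)) refl

    -- Expanding det M along its first row and each minor along its first
    -- column gives M₀₀ · det (minor 0 M) plus a double sum that is symmetric
    -- under transposition.
    detᵀ-step : ∀ {k} → DetᵀInvariant k → DetᵀInvariant (suc k) → DetᵀInvariant (suc (suc k))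
    detᵀ-step {k} detᵀₖ detᵀₖ₊₁ M = begin
      det M
        ≈⟨ +-cong (*-congˡ (detᵀₖ₊₁ (minor zero M))) (-‿cong (altsum-cong (λ l → *-congˡ {M zero (suc l)} (expand M l)))) ⟩
      M zero zero * det (minor zero (M ᵀ)) - altsum (λ l → M zero (suc l) * altsum (λ i → M (suc i) zero * det (minor₂ M i l)))
        ≈⟨ +-congˡ (-‿cong (altsum-altsum-swap (λ l → M zero (suc l)) (λ i → M (suc i) zero) (λ i l → det (minor₂ M i l)))) ⟩
      M zero zero * det (minor zero (M ᵀ)) - altsum (λ l → M (suc l) zero * altsum (λ i → M zero (suc i) * det (minor₂ M l i)))
        ≈⟨ +-congˡ (-‿cong (altsum-cong (λ l → *-congˡ {M (suc l) zero} (expandᵀ l)))) ⟨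
      det (M ᵀ) ∎
      where
      minor₂ : Mat (suc (suc k)) (suc (suc k)) → Fin (suc k) → Fin (suc k) → Mat k k
      minor₂ N i l a b = N (suc (punchIn i a)) (suc (punchIn l b))
      expand : ∀ N l → det (minor (suc l) N) ≈ altsum (λ i → N (suc i) zero * det (minor₂ N i l))
      expand N l = trans (detᵀₖ₊₁ (minor (suc l) N)) (altsum-cong (λ i → *-congˡ {N (suc i) zero} (sym (detᵀₖ (minor₂ N i l)))))
      expandᵀ : ∀ l → det (minor (suc l) (M ᵀ)) ≈ altsum (λ i → M zero (suc i) * det (minor₂ M l i))
      expandᵀ l = trans (expand (M ᵀ) l) (altsum-cong (λ i → *-congˡ {M zero (suc i)} (sym (detᵀₖ (minor₂ M l i)))))

    detᵀ-upTo : ∀ k → DetᵀInvariant k × DetᵀInvariant (suc k)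
    detᵀ-upTo zero    = (λ M → refl) , (λ M → refl)
    detᵀ-upTo (suc k) = proj₂ (detᵀ-upTo k) , uncurry detᵀ-step (detᵀ-upTo k)

  detᵀ : ∀ {k} (M : Mat k k) → det M ≈ det (M ᵀ)
  detᵀ {k} = proj₁ (detᵀ-upTo k)

  columnMinor : ∀ {k} → Fin (suc k) → Mat (suc k) (suc k) → Mat k k
  columnMinor j M a b = M (punchIn j a) (suc b)

  det-expandColumn : ∀ {k} (M : Mat (suc k) (suc k)) → det M ≈ altsum (λ j → M j zero * det (columnMinor j M))
  det-expandColumn M = trans (detᵀ M) (altsum-cong (λ j → *-congˡ {M j zero} (sym (detᵀ (columnMinor j M)))))

  moveToTop : ∀ {k} {X : Set c} → Fin (suc k) → (Fin (suc k) → X) → Fin (suc k) → X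
  moveToTop j M zero    = M j
  moveToTop j M (suc a) = M (punchIn j a)

  swapTop : ∀ {k} {X : Set c} → (Fin (suc (suc k)) → X) → Fin (suc (suc k)) → X
  swapTop M zero          = M (suc zero)
  swapTop M (suc zero)    = M zero
  swapTop M (suc (suc a)) = M (suc (suc a))

  private
    RepeatedTopRowVanishes : ℕ → Set _
    RepeatedTopRowVanishes t = ∀ (M : Mat (suc t) (suc t)) (i : Fin t) → (∀ b → M zero b ≈ M (suc i) b) → det M ≈ 0#

    MoveToTopIsSigned : ℕ → Set _
    MoveToTopIsSigned u = ∀ (M : Mat (suc u) (suc u)) (j : Fin (suc u)) → det (moveToTop j M) ≈ sign j * det M

    SwapTopNegates : ℕ → Set _
    SwapTopNegates t = ∀ (M : Mat (suc (suc t)) (suc (suc t))) → det (swapTop M) ≈ - det M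

    -- Expanding along the first column, only the repeated row survives,
    -- and it cancels the first term after moving it to the top.
    repeated-step : ∀ {t} → RepeatedTopRowVanishes t → MoveToTopIsSigned t → RepeatedTopRowVanishes (suc t)
    repeated-step {t} repeatedₜ moveₜ M i M₀≈Mᵢ = begin
      det M                                                ≈⟨ det-expandColumn M ⟩
      M zero zero * det R₀ - altsum term                   ≈⟨ +-congˡ (-‿cong (altsum-single term i term≈0)) ⟩
      M zero zero * det R₀ - sign i * term i
        ≈⟨ +-congˡ (-‿cong (*-congˡ (*-cong (sym (M₀≈Mᵢ zero)) (trans (det-cong Rᵢ≈) (moveₜ R₀ i))))) ⟩
      M zero zero * det R₀ - sign i * (M zero zero * (sign i * det R₀))
        ≈⟨ +-congˡ (-‿cong (solve 3 (λ s a d → s :* (a :* (s :* d)) := (s :* s) :* (a :* d)) refl (sign i) (M zero zero) (det R₀))) ⟩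
      M zero zero * det R₀ - (sign i * sign i) * (M zero zero * det R₀)
        ≈⟨ +-congˡ (-‿cong (trans (*-congʳ (sign²≈1 i)) (*-identityˡ _))) ⟩
      M zero zero * det R₀ - M zero zero * det R₀          ≈⟨ -‿inverseʳ _ ⟩
      0#                                                   ∎
      where
      R₀ : Mat (suc t) (suc t)
      R₀ = columnMinor zero M
      term : Fin (suc t) → Carrier
      term j = M (suc j) zero * det (columnMinor (suc j) M)
      term≈0 : ∀ j → j ≢ i → term j ≈ 0#
      term≈0 j j≢i = trans (*-congˡ (repeatedₜ (columnMinor (suc j) M) (punchOut j≢i) repeated)) (zeroʳ _)
        where
        repeated : ∀ b → M zero (suc b) ≈ M (suc (punchIn j (punchOut j≢i))) (suc b)
        repeated b = trans (M₀≈Mᵢ (suc b)) (reflexive (≡.cong (λ r → M (suc r) (suc b)) (≡.sym (Fin.punchIn-punchOut j≢i))))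
      Rᵢ≈ : columnMinor (suc i) M ≈ᴹ moveToTop i R₀
      Rᵢ≈ zero    b = M₀≈Mᵢ (suc b)
      Rᵢ≈ (suc a) b = refl

    move-step : ∀ {u} → MoveToTopIsSigned u → SwapTopNegates u → MoveToTopIsSigned (suc u)
    move-step moveᵤ swapᵤ M zero = sym (*-identityˡ _)
    move-step {u} moveᵤ swapᵤ M (suc j) = begin
      det (moveToTop (suc j) M)                                ≈⟨ det-cong moved≈ ⟩
      det (swapTop K)                                          ≈⟨ swapᵤ K ⟩
      - det K                                                  ≈⟨ -‿cong (altsum-cong (λ l → *-congˡ {M zero l} (trans (det-cong (minor≈ l)) (moveᵤ (minor l M) j)))) ⟩
      - altsum (λ l → M zero l * (sign j * det (minor l M)))
        ≈⟨ -‿cong (altsum-cong (λ l → solve 3 (λ a s d → a :* (s :* d) := s :* (a :* d)) refl (M zero l) (sign j) (det (minor l M)))) ⟩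
      - altsum (λ l → sign j * (M zero l * det (minor l M)))   ≈⟨ -‿cong (*-distribˡ-altsum (sign j) (λ l → M zero l * det (minor l M))) ⟨
      - (sign j * det M)                                       ≈⟨ -‿distribˡ-* _ _ ⟩
      - sign j * det M                                         ∎
      where
      K : Mat (suc (suc u)) (suc (suc u))
      K zero    = M zero
      K (suc a) = moveToTop j (λ a′ → M (suc a′)) a
      moved≈ : moveToTop (suc j) M ≈ᴹ swapTop K
      moved≈ zero          b = refl
      moved≈ (suc zero)    b = refl
      moved≈ (suc (suc a)) b = refl
      minor≈ : ∀ l → minor l K ≈ᴹ moveToTop j (minor l M)
      minor≈ l zero    b = refl
      minor≈ l (suc a) b = refl

    -- Φ x y is the determinant with top rows x, y; it is bilinear and
    -- vanishes on the diagonal, hence antisymmetric.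
    swap-step : ∀ {t} → RepeatedTopRowVanishes (suc t) → SwapTopNegates t
    swap-step {t} repeated M = begin
      det (swapTop M) ≈⟨ refl ⟩
      Φ y x           ≈⟨ y+x≈0⇒x≈-y (Φ x y) (Φ y x) Φxy+Φyx≈0 ⟩
      - Φ x y         ≈⟨ refl ⟩
      - det M         ∎
      where
      D : Fin (suc (suc t)) → Fin (suc t) → Carrier
      D l l′ = det {t} (λ a b → M (suc (suc a)) (punchIn l (punchIn l′ b)))
      row : Vect (suc (suc t)) → Fin (suc (suc t)) → Carrier
      row q l = altsum (λ l′ → q (punchIn l l′) * D l l′)
      row-+ : ∀ q q′ l → row (q +ᵛ q′) l ≈ row q l + row q′ l
      row-+ q q′ l = trans (altsum-cong (λ l′ → distribʳ (D l l′) (q (punchIn l l′)) (q′ (punchIn l l′))))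
                           (altsum-distrib-+ (λ l′ → q (punchIn l l′) * D l l′) (λ l′ → q′ (punchIn l l′) * D l l′))
      Φ : Vect (suc (suc t)) → Vect (suc (suc t)) → Carrier
      Φ p q = altsum (λ l → p l * row q l)
      withTopRows : Vect (suc (suc t)) → Vect (suc (suc t)) → Mat (suc (suc t)) (suc (suc t))
      withTopRows p q zero          = p
      withTopRows p q (suc zero)    = q
      withTopRows p q (suc (suc a)) = M (suc (suc a))
      Φ-diagonal : ∀ p → Φ p p ≈ 0#
      Φ-diagonal p = repeated (withTopRows p p) zero (λ b → refl)
      Φ-+ˡ : ∀ p p′ q → Φ (p +ᵛ p′) q ≈ Φ p q + Φ p′ q
      Φ-+ˡ p p′ q = trans (altsum-cong (λ l → distribʳ (row q l) (p l) (p′ l)))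
                          (altsum-distrib-+ (λ l → p l * row q l) (λ l → p′ l * row q l))
      Φ-+ʳ : ∀ p q q′ → Φ p (q +ᵛ q′) ≈ Φ p q + Φ p q′
      Φ-+ʳ p q q′ = trans (altsum-cong (λ l → trans (*-congˡ {p l} (row-+ q q′ l)) (distribˡ (p l) (row q l) (row q′ l))))
                          (altsum-distrib-+ (λ l → p l * row q l) (λ l → p l * row q′ l))
      x = M zero
      y = M (suc zero)
      Φxy+Φyx≈0 : Φ x y + Φ y x ≈ 0#
      Φxy+Φyx≈0 = begin
        Φ x y + Φ y x                        ≈⟨ +-cong (+-identityˡ _) (+-identityʳ _) ⟨
        (0# + Φ x y) + (Φ y x + 0#)          ≈⟨ +-cong (+-congʳ (Φ-diagonal x)) (+-congˡ (Φ-diagonal y)) ⟨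
        (Φ x x + Φ x y) + (Φ y x + Φ y y)    ≈⟨ +-cong (Φ-+ʳ x x y) (Φ-+ʳ y x y) ⟨
        Φ x (x +ᵛ y) + Φ y (x +ᵛ y)          ≈⟨ Φ-+ˡ x y (x +ᵛ y) ⟨
        Φ (x +ᵛ y) (x +ᵛ y)                  ≈⟨ Φ-diagonal (x +ᵛ y) ⟩
        0#                                   ∎
      y+x≈0⇒x≈-y : ∀ a b → a + b ≈ 0# → b ≈ - a
      y+x≈0⇒x≈-y a b a+b≈0 = begin
        b            ≈⟨ solve 2 (λ a b → b := (a :+ b) :- a) refl a b ⟩
        (a + b) - a  ≈⟨ +-congʳ a+b≈0 ⟩
        0# - a       ≈⟨ +-identityˡ _ ⟩
        - a          ∎

    alternating-upTo : ∀ t → RepeatedTopRowVanishes t × MoveToTopIsSigned t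
    alternating-upTo zero = (λ M ()) , λ { M zero → sym (*-identityˡ _) }
    alternating-upTo (suc t) = repeatedₜ₊₁ , move-step (proj₂ (alternating-upTo t)) (swap-step repeatedₜ₊₁)
      where
      repeatedₜ₊₁ : RepeatedTopRowVanishes (suc t)
      repeatedₜ₊₁ = uncurry repeated-step (alternating-upTo t)

  det-repeatedTopRow : ∀ {t} (M : Mat (suc t) (suc t)) (i : Fin t) → (∀ b → M zero b ≈ M (suc i) b) → det M ≈ 0#
  det-repeatedTopRow {t} = proj₁ (alternating-upTo t)

  -- Invertibility of injective square matrices

  setRow : ∀ {k} {X : Set c} → Fin k → X → (Fin k → X) → Fin k → X
  setRow zero    v M zero    = v
  setRow zero    v M (suc a) = M (suc a)
  setRow (suc p) v M zero    = M zero
  setRow (suc p) v M (suc a) = setRow p v (λ a′ → M (suc a′)) a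

  setRow-same : ∀ {k} {X : Set c} (p : Fin k) (v : X) M → setRow p v M p ≡ v
  setRow-same zero    v M = ≡.refl
  setRow-same (suc p) v M = setRow-same p v (λ a′ → M (suc a′))

  setRow-other : ∀ {k} {X : Set c} (p r : Fin k) (v : X) M → r ≢ p → setRow p v M r ≡ M r
  setRow-other zero    zero    v M r≢p = ⊥-elim (r≢p ≡.refl)
  setRow-other zero    (suc r) v M r≢p = ≡.refl
  setRow-other (suc p) zero    v M r≢p = ≡.refl
  setRow-other (suc p) (suc r) v M r≢p = setRow-other p r v (λ a′ → M (suc a′)) (λ r≡p → r≢p (≡.cong suc r≡p))

  setRow-self : ∀ {k} {X : Set c} (p : Fin k) (M : Fin k → X) r → setRow p (M p) M r ≡ M r
  setRow-self p M r with r Fin.≟ p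
  ... | yes ≡.refl = setRow-same p (M p) M
  ... | no  r≢p    = setRow-other p r (M p) M r≢p

  setRow-reindex : ∀ {k n m} (p : Fin k) (v : Vect n) (M : Fin k → Vect n) (f : Fin m → Fin n) a b →
                   setRow p v M a (f b) ≡ setRow p (λ b′ → v (f b′)) (λ a′ b′ → M a′ (f b′)) a b
  setRow-reindex zero    v M f zero    b = ≡.refl
  setRow-reindex zero    v M f (suc a) b = ≡.refl
  setRow-reindex (suc p) v M f zero    b = ≡.refl
  setRow-reindex (suc p) v M f (suc a) b = setRow-reindex p v (λ a′ → M (suc a′)) f a b

  det-setRow-linear : ∀ {k} (M : Mat (suc k) (suc k)) (p : Fin (suc k)) (x z : Vect (suc k)) s →
                      det (setRow p (λ b → x b + s * z b) M) ≈ det (setRow p x M) + s * det (setRow p z M)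
  det-setRow-linear {k} M zero x z s = begin
    altsum (λ l → (x l + s * z l) * d l)
      ≈⟨ altsum-cong (λ l → solve 4 (λ a b s d → (a :+ s :* b) :* d := a :* d :+ s :* (b :* d)) refl (x l) (z l) s (d l)) ⟩
    altsum (λ l → x l * d l + s * (z l * d l))          ≈⟨ altsum-distrib-+ (λ l → x l * d l) (λ l → s * (z l * d l)) ⟩
    altsum (λ l → x l * d l) + altsum (λ l → s * (z l * d l)) ≈⟨ +-congˡ (*-distribˡ-altsum s (λ l → z l * d l)) ⟨
    altsum (λ l → x l * d l) + s * altsum (λ l → z l * d l)   ∎
    where
    d : Fin (suc k) → Carrier
    d l = det (minor l M)
  det-setRow-linear {suc k} M (suc p) x z s = begin
    altsum (λ l → M zero l * det (minor l (setRow (suc p) w M)))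
      ≈⟨ altsum-cong (λ l → *-congˡ {M zero l} (trans (det-cong (minor-setRow w l))
                       (det-setRow-linear (minor l M) p (λ b → x (punchIn l b)) (λ b → z (punchIn l b)) s))) ⟩
    altsum (λ l → M zero l * (det (U x l) + s * det (U z l)))
      ≈⟨ altsum-cong (λ l → solve 4 (λ m a s b → m :* (a :+ s :* b) := m :* a :+ s :* (m :* b)) refl (M zero l) (det (U x l)) s (det (U z l))) ⟩
    altsum (λ l → M zero l * det (U x l) + s * (M zero l * det (U z l)))
      ≈⟨ altsum-distrib-+ (λ l → M zero l * det (U x l)) (λ l → s * (M zero l * det (U z l))) ⟩
    altsum (λ l → M zero l * det (U x l)) + altsum (λ l → s * (M zero l * det (U z l)))
      ≈⟨ +-congˡ (*-distribˡ-altsum s (λ l → M zero l * det (U z l))) ⟨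
    altsum (λ l → M zero l * det (U x l)) + s * altsum (λ l → M zero l * det (U z l))
      ≈⟨ +-cong (altsum-cong (λ l → *-congˡ {M zero l} (det-cong (minor-setRow x l))))
                (*-congˡ (altsum-cong (λ l → *-congˡ {M zero l} (det-cong (minor-setRow z l))))) ⟨
    det (setRow (suc p) x M) + s * det (setRow (suc p) z M) ∎
    where
    w : Vect (suc (suc k))
    w b = x b + s * z b
    U : Vect (suc (suc k)) → Fin (suc (suc k)) → Mat (suc k) (suc k)
    U v l = setRow p (λ b → v (punchIn l b)) (minor l M)
    minor-setRow : ∀ v l → minor l (setRow (suc p) v M) ≈ᴹ U v l
    minor-setRow v l a b = reflexive (setRow-reindex p v (λ a′ → M (suc a′)) (punchIn l) a b)

  det-zeroColumn : ∀ {k} (M : Mat (suc k) (suc k)) → (∀ a → M a zero ≈ 0#) → det M ≈ 0#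
  det-zeroColumn M M·₀≈0 = trans (det-expandColumn M)
    (altsum-zero (λ j → M j zero * det (columnMinor j M)) (λ j → trans (*-congʳ (M·₀≈0 j)) (zeroˡ _)))

  det-clearedColumn : ∀ {k} (M : Mat (suc k) (suc k)) → (∀ p → M (suc p) zero ≈ 0#) →
                      det M ≈ M zero zero * det (minor zero M)
  det-clearedColumn {zero}  M cleared = trans (+-congˡ -0#≈0#) (+-identityʳ _)
  det-clearedColumn {suc k} M cleared = begin
    M zero zero * det (minor zero M) - altsum (λ l → M zero (suc l) * det (minor (suc l) M))
      ≈⟨ +-congˡ (-‿cong (altsum-zero (λ l → M zero (suc l) * det (minor (suc l) M))
                           (λ l → trans (*-congˡ (det-zeroColumn (minor (suc l) M) cleared)) (zeroʳ _)))) ⟩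
    M zero zero * det (minor zero M) - 0#   ≈⟨ +-congˡ -0#≈0# ⟩
    M zero zero * det (minor zero M) + 0#   ≈⟨ +-identityʳ _ ⟩
    M zero zero * det (minor zero M)        ∎

  rowAdd : ∀ {k n} → Fin k → Fin k → Carrier → Mat k n → Mat k n
  rowAdd p q s M = setRow p (λ b → M p b + s * M q b) M

  det-rowAdd : ∀ {k} (M : Mat (suc k) (suc k)) p q s → det (setRow p (M q) M) ≈ 0# → det (rowAdd p q s M) ≈ det M
  det-rowAdd M p q s repeated = begin
    det (rowAdd p q s M)                                   ≈⟨ det-setRow-linear M p (M p) (M q) s ⟩
    det (setRow p (M p) M) + s * det (setRow p (M q) M)    ≈⟨ +-cong (det-cong (λ r b → reflexive (≡.cong (λ row → row b) (setRow-self p M r)))) (*-congˡ repeated) ⟩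
    det M + s * 0#                                         ≈⟨ +-congˡ (zeroʳ s) ⟩
    det M + 0#                                             ≈⟨ +-identityʳ _ ⟩
    det M                                                  ∎

  Injective : ∀ {m k} → Mat m k → Set (c ⊔ ℓ)
  Injective M = ∀ x → (M · x) ≈ᵛ 0ᵛ → x ≈ᵛ 0ᵛ

  ·-linearˡ : ∀ {n} (u v x : Vect n) s → ∑ (λ j → (u j + s * v j) * x j) ≈ ∑ (λ j → u j * x j) + s * ∑ (λ j → v j * x j)
  ·-linearˡ u v x s = begin
    ∑ (λ j → (u j + s * v j) * x j)
      ≈⟨ ∑-cong (λ j → solve 4 (λ a b s x → (a :+ s :* b) :* x := a :* x :+ s :* (b :* x)) refl (u j) (v j) s (x j)) ⟩
    ∑ (λ j → u j * x j + s * (v j * x j))                    ≈⟨ ∑-distrib-+ (λ j → u j * x j) (λ j → s * (v j * x j)) ⟩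
    ∑ (λ j → u j * x j) + ∑ (λ j → s * (v j * x j))          ≈⟨ +-congˡ (*-distribˡ-∑ s (λ j → v j * x j)) ⟨
    ∑ (λ j → u j * x j) + s * ∑ (λ j → v j * x j)            ∎

  rowAdd-injective : ∀ {k n} (M : Mat k n) p q s → q ≢ p → Injective M → Injective (rowAdd p q s M)
  rowAdd-injective M p q s q≢p M-inj x M′x≈0 = M-inj x Mx≈0
    where
    w = λ b → M p b + s * M q b
    row≈ : ∀ r → r ≢ p → ((M · x) r) ≈ (rowAdd p q s M · x) r
    row≈ r r≢p = reflexive (≡.cong (λ row → ∑ (λ j → row j * x j)) (≡.sym (setRow-other p r w M r≢p)))
    Mx≈0 : (M · x) ≈ᵛ 0ᵛ
    Mx≈0 r with r Fin.≟ p
    ... | no  r≢p    = trans (row≈ r r≢p) (M′x≈0 r)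
    ... | yes ≡.refl = begin
      (M · x) r                                    ≈⟨ solve 3 (λ a b s → a := (a :+ s :* b) :- s :* b) refl ((M · x) r) ((M · x) q) s ⟩
      ((M · x) r + s * (M · x) q) - s * (M · x) q  ≈⟨ +-cong (·-linearˡ (M r) (M q) x s) (-‿cong (*-congˡ (sym (trans (row≈ q q≢p) (M′x≈0 q))))) ⟨
      ∑ (λ j → w j * x j) - s * 0#                 ≈⟨ +-cong (trans (reflexive (≡.cong (λ row → ∑ (λ j → row j * x j)) (≡.sym (setRow-same p w M)))) (M′x≈0 p)) (-‿cong (zeroʳ s)) ⟩
      0# - 0#                                      ≈⟨ -‿inverseʳ _ ⟩
      0#                                           ∎

  moveToTop-injective : ∀ {k n} (j : Fin (suc k)) (M : Mat (suc k) n) → Injective M → Injective (moveToTop j M)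
  moveToTop-injective j M M-inj x M′x≈0 = M-inj x Mx≈0
    where
    Mx≈0 : (M · x) ≈ᵛ 0ᵛ
    Mx≈0 r with r Fin.≟ j
    ... | yes ≡.refl = M′x≈0 zero
    ... | no  r≢j    = trans (reflexive (≡.cong (λ r′ → (M · x) r′) (≡.sym (Fin.punchIn-punchOut j≢r))))
                             (M′x≈0 (suc (punchOut j≢r)))
      where
      j≢r : j ≢ r
      j≢r j≡r = r≢j (≡.sym j≡r)

  ¬¬-∀-Fin : ∀ {n} {P : Fin n → Set ℓ} → (∀ i → ¬ ¬ P i) → ¬ ¬ (∀ i → P i)
  ¬¬-∀-Fin {zero}      ¬¬P ¬∀P = ¬∀P (λ ())
  ¬¬-∀-Fin {suc n} {P} ¬¬P ¬∀P = ¬¬P zero (λ P₀ → ¬¬-∀-Fin {n} {λ i → P (suc i)} (λ i → ¬¬P (suc i))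
                                   (λ P₊ → ¬∀P (λ { zero → P₀ ; (suc i) → P₊ i })))

  ¬¬-pivot : ∀ {s} (M : Mat (suc s) (suc s)) → Injective M → ¬ ¬ (∃ λ i → ¬ (M i zero ≈ 0#))
  ¬¬-pivot {s} M M-inj ¬pivot = ¬¬-∀-Fin (λ i M·₀≉0 → ¬pivot (i , M·₀≉0)) column≈0⇒⊥
    where
    e₀ : Vect (suc s)
    e₀ zero    = 1#
    e₀ (suc _) = 0#
    column≈0⇒⊥ : (∀ i → M i zero ≈ 0#) → ⊥
    column≈0⇒⊥ M·₀≈0 = 0≉1 (sym (M-inj e₀ Me₀≈0 zero))
      where
      Me₀≈0 : (M · e₀) ≈ᵛ 0ᵛ
      Me₀≈0 r = trans (+-cong (trans (*-identityʳ _) (M·₀≈0 r)) (∑-zero (λ j → M r (suc j) * 0#) (λ j → zeroʳ _))) (+-identityʳ _)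

  minor-injective : ∀ {s} (M : Mat (suc s) (suc s)) y → M zero zero * y ≈ 1# →
                    (∀ p → M (suc p) zero ≈ 0#) → Injective M → Injective (minor zero M)
  minor-injective {s} M y m*y≈1 cleared M-inj v minor·v≈0 q = M-inj x Mx≈0 (suc q)
    where
    m = M zero zero
    S = ∑ (λ q → M zero (suc q) * v q)
    x : Vect (suc s)
    x zero    = - (y * S)
    x (suc q) = v q
    Mx≈0 : (M · x) ≈ᵛ 0ᵛ
    Mx≈0 zero = begin
      m * - (y * S) + S ≈⟨ solve 3 (λ m y S → m :* (:- (y :* S)) :+ S := S :- (m :* y) :* S) refl m y S ⟩
      S - (m * y) * S   ≈⟨ +-congˡ (-‿cong (trans (*-congʳ m*y≈1) (*-identityˡ _))) ⟩
      S - S             ≈⟨ -‿inverseʳ _ ⟩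
      0#                ∎
    Mx≈0 (suc p) = trans (+-cong (trans (*-congʳ (cleared p)) (zeroˡ _)) (minor·v≈0 p)) (+-identityʳ _)

  private
    -- Gaussian elimination in the first column, clearing the rows below
    -- the pivot from the last one upwards: rows with index ≥ q are cleared.
    det≉0-pivoted : ∀ {s} → (∀ (N : Mat s s) → Injective N → ¬ (det N ≈ 0#)) →
      (q : ℕ) (M : Mat (suc s) (suc s)) (y : Carrier) → M zero zero * y ≈ 1# →
      (∀ (p : Fin s) → q ℕ.≤ Fin.toℕ p → M (suc p) zero ≈ 0#) → Injective M → ¬ (det M ≈ 0#)
    det≉0-pivoted det≉0ₛ zero M y m*y≈1 cleared M-inj detM≈0 =
      det≉0ₛ (minor zero M) (minor-injective M y m*y≈1 cleared′ M-inj) (begin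
        det (minor zero M)                   ≈⟨ *-identityˡ _ ⟨
        1# * det (minor zero M)              ≈⟨ *-congʳ (trans (sym m*y≈1) (*-comm _ _)) ⟩
        (y * m) * det (minor zero M)         ≈⟨ *-assoc _ _ _ ⟩
        y * (m * det (minor zero M))         ≈⟨ *-congˡ (trans (sym (det-clearedColumn M cleared′)) detM≈0) ⟩
        y * 0#                               ≈⟨ zeroʳ _ ⟩
        0#                                   ∎)
      where
      m = M zero zero
      cleared′ : ∀ p → M (suc p) zero ≈ 0#
      cleared′ p = cleared p ℕ.z≤n
    det≉0-pivoted {s} det≉0ₛ (suc q) M y m*y≈1 cleared M-inj detM≈0 with q ℕ.<? s
    ... | no  q≮s = det≉0-pivoted det≉0ₛ q M y m*y≈1 (λ p q≤p → ⊥-elim (q≮s (ℕ.≤-<-trans q≤p (Fin.toℕ<n p)))) M-inj detM≈0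
    ... | yes q<s = det≉0-pivoted det≉0ₛ q M′ y m*y≈1 cleared′ (rowAdd-injective M (suc p₀) zero t (λ ()) M-inj)
                      (trans (det-rowAdd M (suc p₀) zero t repeated) detM≈0)
      where
      p₀ = Fin.fromℕ< q<s
      a = M (suc p₀) zero
      t = - (a * y)
      M′ : Mat (suc s) (suc s)
      M′ = rowAdd (suc p₀) zero t M
      repeated : det (setRow (suc p₀) (M zero) M) ≈ 0#
      repeated = det-repeatedTopRow (setRow (suc p₀) (M zero) M) p₀
                   (λ b → reflexive (≡.cong (λ row → row b) (≡.sym (setRow-same (suc p₀) (M zero) M))))
      cleared′ : ∀ (p : Fin s) → q ℕ.≤ Fin.toℕ p → M′ (suc p) zero ≈ 0#
      cleared′ p q≤p with p Fin.≟ p₀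
      ... | yes ≡.refl = begin
        M′ (suc p₀) zero          ≡⟨ ≡.cong (λ row → row zero) (setRow-same (suc p₀) _ M) ⟩
        a + - (a * y) * M zero zero ≈⟨ solve 3 (λ a y m → a :+ (:- (a :* y)) :* m := a :- a :* (m :* y)) refl a y (M zero zero) ⟩
        a - a * (M zero zero * y) ≈⟨ +-congˡ (-‿cong (trans (*-congˡ m*y≈1) (*-identityʳ _))) ⟩
        a - a                     ≈⟨ -‿inverseʳ _ ⟩
        0#                        ∎
      ... | no  p≢p₀ = trans (reflexive (≡.cong (λ row → row zero) (setRow-other (suc p₀) (suc p) _ M (λ sp≡sp₀ → p≢p₀ (Fin.suc-injective sp≡sp₀)))))
                             (cleared p (ℕ.≤∧≢⇒< q≤p (λ q≡p → p≢p₀ (Fin.toℕ-injective (≡.trans (≡.sym q≡p) (≡.sym (Fin.toℕ-fromℕ< q<s)))))))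

  det≉0 : ∀ {k} (M : Mat k k) → Injective M → ¬ (det M ≈ 0#)
  det≉0 {zero}  M M-inj detM≈0 = 0≉1 (sym detM≈0)
  det≉0 {suc s} M M-inj detM≈0 = ¬¬-pivot M M-inj pivot⇒⊥
    where
    nothingBelow : ∀ (p : Fin s) → s ℕ.≤ Fin.toℕ p → M (suc p) zero ≈ 0#
    nothingBelow p s≤p = ⊥-elim (ℕ.<⇒≱ (Fin.toℕ<n p) s≤p)
    pivot⇒⊥ : (∃ λ i → ¬ (M i zero ≈ 0#)) → ⊥
    pivot⇒⊥ (zero , m≉0) = det≉0-pivoted (det≉0 {s}) s M (proj₁ (inverse _ m≉0)) (proj₂ (inverse _ m≉0)) nothingBelow M-inj detM≈0
    pivot⇒⊥ (suc i , a≉0) = det≉0-pivoted (det≉0 {s}) s M₁ 1# m₁*1≈1 nothingBelow′ (rowAdd-injective M zero (suc i) t (λ ()) M-inj)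
                              (trans (det-rowAdd M zero (suc i) t (det-repeatedTopRow (setRow zero (M (suc i)) M) i (λ b → refl))) detM≈0)
      where
      a = M (suc i) zero
      a⁻¹ = proj₁ (inverse a a≉0)
      m = M zero zero
      t = (1# - m) * a⁻¹
      M₁ : Mat (suc s) (suc s)
      M₁ = rowAdd zero (suc i) t M
      nothingBelow′ : ∀ (p : Fin s) → s ℕ.≤ Fin.toℕ p → M₁ (suc p) zero ≈ 0#
      nothingBelow′ p s≤p = ⊥-elim (ℕ.<⇒≱ (Fin.toℕ<n p) s≤p)
      m₁*1≈1 : M₁ zero zero * 1# ≈ 1#
      m₁*1≈1 = begin
        (m + t * a) * 1#         ≈⟨ *-identityʳ _ ⟩
        m + ((1# - m) * a⁻¹) * a ≈⟨ solve 4 (λ m b a o → m :+ ((o :- m) :* b) :* a := m :+ (o :- m) :* (a :* b)) refl m a⁻¹ a 1# ⟩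
        m + (1# - m) * (a * a⁻¹) ≈⟨ +-congˡ (trans (*-congˡ (proj₂ (inverse a a≉0))) (*-identityʳ _)) ⟩
        m + (1# - m)             ≈⟨ solve 2 (λ m o → m :+ (o :- m) := o) refl m 1# ⟩
        1#                       ∎

  cofactor : ∀ {t} → Mat (suc t) (suc t) → Vect (suc t)
  cofactor K l = sign l * det (minor l K)

  ∑-*-cofactor : ∀ {t} (K : Mat (suc t) (suc t)) (v : Vect (suc t)) → ∑ (λ l → v l * cofactor K l) ≈ det (setRow zero v K)
  ∑-*-cofactor {t} K v =
    trans (∑-cong (λ l → solve 3 (λ a s d → a :* (s :* d) := s :* (a :* d)) refl (v l) (sign l) (det (minor l K))))
          (sym (altsum≈∑-sign (λ l → v l * det (minor l K))))

  Injective⇒rightInverse : ∀ {k} (N : Mat k k) → Injective N → Σ (Mat k k) λ R → (N *ᴹ R) ≈ᴹ 1ᴹ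
  Injective⇒rightInverse {zero}  N N-inj = (λ ()) , (λ ())
  Injective⇒rightInverse {suc t} N N-inj = R , NR≈1
    where
    dⱼ⁻¹ : Fin (suc t) → Carrier
    dⱼ⁻¹ j = proj₁ (inverse _ (det≉0 (moveToTop j N) (moveToTop-injective j N N-inj)))
    dⱼ*dⱼ⁻¹≈1 : ∀ j → det (moveToTop j N) * dⱼ⁻¹ j ≈ 1#
    dⱼ*dⱼ⁻¹≈1 j = proj₂ (inverse _ (det≉0 (moveToTop j N) (moveToTop-injective j N N-inj)))
    -- Column j of R is the first cofactor row of N with row j moved to the
    -- top: row j of N expands the determinant, any other row repeats one.
    R : Mat (suc t) (suc t)
    R l j = dⱼ⁻¹ j * cofactor (moveToTop j N) l
    entry : ∀ r j → ∑ (λ l → N r l * cofactor (moveToTop j N) l) ≈ det (moveToTop j N) * 1ᴹ r j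
    entry r j with r Fin.≟ j
    ... | yes ≡.refl = trans (∑-*-cofactor (moveToTop r N) (N r)) (sym (*-identityʳ _))
    ... | no  r≢j    = begin
      ∑ (λ l → N r l * cofactor (moveToTop j N) l)
        ≡⟨ ≡.cong (λ row → ∑ (λ l → row l * cofactor (moveToTop j N) l)) (≡.cong N (≡.sym (Fin.punchIn-punchOut j≢r))) ⟩
      ∑ (λ l → N (punchIn j a) l * cofactor (moveToTop j N) l) ≈⟨ ∑-*-cofactor (moveToTop j N) (N (punchIn j a)) ⟩
      det (setRow zero (N (punchIn j a)) (moveToTop j N))      ≈⟨ det-repeatedTopRow (setRow zero (N (punchIn j a)) (moveToTop j N)) a (λ b → refl) ⟩
      0#                                                       ≈⟨ zeroʳ _ ⟨
      det (moveToTop j N) * 0#                                 ∎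
      where
      j≢r : j ≢ r
      j≢r j≡r = r≢j (≡.sym j≡r)
      a = punchOut j≢r
    NR≈1 : (N *ᴹ R) ≈ᴹ 1ᴹ
    NR≈1 r j = begin
      ∑ (λ l → N r l * (dⱼ⁻¹ j * cofactor (moveToTop j N) l))
        ≈⟨ ∑-cong (λ l → solve 3 (λ a b c → a :* (b :* c) := b :* (a :* c)) refl (N r l) (dⱼ⁻¹ j) (cofactor (moveToTop j N) l)) ⟩
      ∑ (λ l → dⱼ⁻¹ j * (N r l * cofactor (moveToTop j N) l))  ≈⟨ *-distribˡ-∑ (dⱼ⁻¹ j) (λ l → N r l * cofactor (moveToTop j N) l) ⟨
      dⱼ⁻¹ j * ∑ (λ l → N r l * cofactor (moveToTop j N) l)    ≈⟨ *-congˡ (entry r j) ⟩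
      dⱼ⁻¹ j * (det (moveToTop j N) * 1ᴹ r j)                  ≈⟨ sym (*-assoc _ _ _) ⟩
      (dⱼ⁻¹ j * det (moveToTop j N)) * 1ᴹ r j                  ≈⟨ *-congʳ (trans (*-comm _ _) (dⱼ*dⱼ⁻¹≈1 j)) ⟩
      1# * 1ᴹ r j                                              ≈⟨ *-identityˡ _ ⟩
      1ᴹ r j                                                   ∎

  infixl 6 _+ᴹ_

  _+ᴹ_ : ∀ {a b} → Mat a b → Mat a b → Mat a b
  (M +ᴹ N) i j = M i j + N i j

  negᴹ : ∀ {a b} → Mat a b → Mat a b
  negᴹ M i j = - M i j

  0ᴹ : ∀ {a b} → Mat a b
  0ᴹ i j = 0#

  ≈ᴹ-setoid : ℕ → ℕ → Setoid c ℓ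
  ≈ᴹ-setoid a b = record
    { Carrier       = Mat a b
    ; _≈_           = _≈ᴹ_
    ; isEquivalence = record
      { refl  = λ i j → refl
      ; sym   = λ M≈N i j → sym (M≈N i j)
      ; trans = λ M≈N N≈O i j → trans (M≈N i j) (N≈O i j)
      }
    }

  module _ {a b : ℕ} where
    open Setoid (≈ᴹ-setoid a b) public
      using () renaming (refl to ≈ᴹ-refl; sym to ≈ᴹ-sym; trans to ≈ᴹ-trans)

  +ᴹ-cong : ∀ {a b} {M M′ N N′ : Mat a b} → M ≈ᴹ M′ → N ≈ᴹ N′ → (M +ᴹ N) ≈ᴹ (M′ +ᴹ N′)
  +ᴹ-cong M≈M′ N≈N′ i j = +-cong (M≈M′ i j) (N≈N′ i j)

  negᴹ-injective : ∀ {a b} {M N : Mat a b} → negᴹ M ≈ᴹ negᴹ N → M ≈ᴹ N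
  negᴹ-injective -M≈-N i j = trans (sym (-‿involutive _)) (trans (-‿cong (-M≈-N i j)) (-‿involutive _))

  *ᴹ-cong : ∀ {a b d} {M M′ : Mat a b} {N N′ : Mat b d} → M ≈ᴹ M′ → N ≈ᴹ N′ → (M *ᴹ N) ≈ᴹ (M′ *ᴹ N′)
  *ᴹ-cong M≈M′ N≈N′ i j = ∑-cong (λ k → *-cong (M≈M′ i k) (N≈N′ k j))

  *ᴹ-congˡ : ∀ {a b d} {M : Mat a b} {N N′ : Mat b d} → N ≈ᴹ N′ → (M *ᴹ N) ≈ᴹ (M *ᴹ N′)
  *ᴹ-congˡ = *ᴹ-cong ≈ᴹ-refl

  *ᴹ-congʳ : ∀ {a b d} {M M′ : Mat a b} {N : Mat b d} → M ≈ᴹ M′ → (M *ᴹ N) ≈ᴹ (M′ *ᴹ N)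
  *ᴹ-congʳ M≈M′ = *ᴹ-cong M≈M′ ≈ᴹ-refl

  *ᴹ-assoc : ∀ {a b d e} (M : Mat a b) (N : Mat b d) (O : Mat d e) → ((M *ᴹ N) *ᴹ O) ≈ᴹ (M *ᴹ (N *ᴹ O))
  *ᴹ-assoc {b = b} {d = d} M N O i j = begin
    ∑ (λ k → ∑ (λ l → M i l * N l k) * O k j)    ≈⟨ ∑-cong {d} (λ k → trans (*-comm _ _) (trans (*-distribˡ-∑ (O k j) (λ l → M i l * N l k))
                                                      (∑-cong {b} (λ l → solve 3 (λ o m n → o :* (m :* n) := m :* (n :* o)) refl (O k j) (M i l) (N l k))))) ⟩
    ∑ (λ k → ∑ (λ l → M i l * (N l k * O k j)))  ≈⟨ ∑-comm (λ k l → M i l * (N l k * O k j)) ⟩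
    ∑ (λ l → ∑ (λ k → M i l * (N l k * O k j)))  ≈⟨ ∑-cong {b} (λ l → *-distribˡ-∑ (M i l) (λ k → N l k * O k j)) ⟨
    ∑ (λ l → M i l * ∑ (λ k → N l k * O k j))    ∎

  *ᴹ-negʳ : ∀ {a b d} (M : Mat a b) (N : Mat b d) → (M *ᴹ negᴹ N) ≈ᴹ negᴹ (M *ᴹ N)
  *ᴹ-negʳ M N i j = trans (∑-cong (λ k → sym (-‿distribʳ-* (M i k) (N k j)))) (∑-neg (λ k → M i k * N k j))

  *ᴹ-zeroʳ : ∀ {a b d} (M : Mat a b) → (M *ᴹ (0ᴹ {b} {d})) ≈ᴹ 0ᴹ
  *ᴹ-zeroʳ M i j = ∑-zero (λ k → M i k * 0#) (λ k → zeroʳ _)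

  *ᴹ-identityʳ : ∀ {a b} (M : Mat a b) → (M *ᴹ 1ᴹ) ≈ᴹ M
  *ᴹ-identityʳ M i j = ∑-*-1ᴹ (M i) j

  *ᴹ-identityˡ : ∀ {a b} (M : Mat a b) → (1ᴹ *ᴹ M) ≈ᴹ M
  *ᴹ-identityˡ M i j = trans (∑-cong (λ k → trans (*-comm (1ᴹ i k) (M k j)) (*-congˡ (1ᴹ-sym i k)))) (∑-*-1ᴹ (λ k → M k j) i)

  column : ∀ {a} → Vect a → Mat a 1
  column x k _ = x k

  ·-assoc : ∀ {a b d} (M : Mat a b) (N : Mat b d) (x : Vect d) → ((M *ᴹ N) · x) ≈ᵛ (M · (N · x))
  ·-assoc M N x i = *ᴹ-assoc M N (column x) i zero

  ·-congˡ : ∀ {a b} {M N : Mat a b} (x : Vect b) → M ≈ᴹ N → (M · x) ≈ᵛ (N · x)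
  ·-congˡ x M≈N i = ∑-cong (λ k → *-congʳ (M≈N i k))

  ·-zeroʳ : ∀ {a b} (M : Mat a b) → (M · 0ᵛ) ≈ᵛ 0ᵛ
  ·-zeroʳ M i = ∑-zero (λ k → M i k * 0#) (λ k → zeroʳ _)

  *ᴹ-cancelˡ : ∀ {a b d} (M : Mat a b) {X Y : Mat b d} → Injective M → (M *ᴹ X) ≈ᴹ (M *ᴹ Y) → X ≈ᴹ Y
  *ᴹ-cancelˡ M {X} {Y} M-inj MX≈MY k j = begin
    X k j                      ≈⟨ solve 2 (λ x y → x := (x :- y) :+ y) refl (X k j) (Y k j) ⟩
    (X k j - Y k j) + Y k j    ≈⟨ +-congʳ (M-inj (λ k′ → X k′ j - Y k′ j) M[X-Y]≈0 k) ⟩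
    0# + Y k j                 ≈⟨ +-identityˡ _ ⟩
    Y k j                      ∎
    where
    M[X-Y]≈0 : (M · (λ k′ → X k′ j - Y k′ j)) ≈ᵛ 0ᵛ
    M[X-Y]≈0 i = begin
      ∑ (λ k′ → M i k′ * (X k′ j - Y k′ j))
        ≈⟨ ∑-cong (λ k′ → solve 3 (λ m x y → m :* (x :- y) := m :* x :+ (:- (m :* y))) refl (M i k′) (X k′ j) (Y k′ j)) ⟩
      ∑ (λ k′ → M i k′ * X k′ j + - (M i k′ * Y k′ j))  ≈⟨ ∑-distrib-+ (λ k′ → M i k′ * X k′ j) (λ k′ → - (M i k′ * Y k′ j)) ⟩
      (M *ᴹ X) i j + ∑ (λ k′ → - (M i k′ * Y k′ j))     ≈⟨ +-cong (MX≈MY i j) (∑-neg (λ k′ → M i k′ * Y k′ j)) ⟩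
      (M *ᴹ Y) i j - (M *ᴹ Y) i j                       ≈⟨ -‿inverseʳ _ ⟩
      0#                                                ∎

  RightInvertible : ∀ {a b} → Mat a b → Set (c ⊔ ℓ)
  RightInvertible {a} {b} M = Σ (Mat b a) λ Y → (M *ᴹ Y) ≈ᴹ 1ᴹ

  fixes-rightInvertible⇒≈1ᴹ : ∀ {a b} (G : Mat a a) {C : Mat a b} → RightInvertible C → (G *ᴹ C) ≈ᴹ C → G ≈ᴹ 1ᴹ
  fixes-rightInvertible⇒≈1ᴹ G {C} (Y , CY≈1) GC≈C =
    ≈ᴹ-trans (≈ᴹ-sym (*ᴹ-identityʳ G)) (≈ᴹ-trans (*ᴹ-congˡ (≈ᴹ-sym CY≈1))
      (≈ᴹ-trans (≈ᴹ-sym (*ᴹ-assoc G C Y)) (≈ᴹ-trans (*ᴹ-congʳ GC≈C) CY≈1)))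

  -- Block matrices

  _∥_ : ∀ {a b d} → Mat a b → Mat a d → Mat a (b ℕ.+ d)
  _∥_ {b = b} P Q i k = [ P i , Q i ]′ (splitAt b k)

  _⊤⊥_ : ∀ {b d e} → Mat b e → Mat d e → Mat (b ℕ.+ d) e
  _⊤⊥_ {b = b} X Y k j = [ (λ i → X i j) , (λ i → Y i j) ]′ (splitAt b k)

  ∅ᶜ : ∀ {a} → Mat a 0
  ∅ᶜ i ()

  ∅ʳ : ∀ {e} → Mat 0 e
  ∅ʳ () j

  leftBlock : ∀ {a b d} → Mat a (b ℕ.+ d) → Mat a b
  leftBlock {d = d} M i j = M i (j ↑ˡ d)

  rightBlock : ∀ {a b d} → Mat a (b ℕ.+ d) → Mat a d
  rightBlock {b = b} M i j = M i (b ↑ʳ j)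

  topBlock : ∀ {b d e} → Mat (b ℕ.+ d) e → Mat b e
  topBlock {d = d} T i j = T (i ↑ˡ d) j

  bottomBlock : ∀ {b d e} → Mat (b ℕ.+ d) e → Mat d e
  bottomBlock {b = b} T i j = T (b ↑ʳ i) j

  leftBlock-∥ : ∀ {a b d} (P : Mat a b) (Q : Mat a d) → leftBlock (P ∥ Q) ≈ᴹ P
  leftBlock-∥ {b = b} {d} P Q i j = reflexive (≡.cong [ P i , Q i ]′ (Fin.splitAt-↑ˡ b j d))

  rightBlock-∥ : ∀ {a b d} (P : Mat a b) (Q : Mat a d) → rightBlock (P ∥ Q) ≈ᴹ Q
  rightBlock-∥ {b = b} {d} P Q i j = reflexive (≡.cong [ P i , Q i ]′ (Fin.splitAt-↑ʳ b d j))

  topBlock-⊤⊥ : ∀ {b d e} (X : Mat b e) (Y : Mat d e) → topBlock (X ⊤⊥ Y) ≈ᴹ X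
  topBlock-⊤⊥ {b} {d} X Y i j = reflexive (≡.cong [ (λ i → X i j) , (λ i → Y i j) ]′ (Fin.splitAt-↑ˡ b i d))

  bottomBlock-⊤⊥ : ∀ {b d e} (X : Mat b e) (Y : Mat d e) → bottomBlock (X ⊤⊥ Y) ≈ᴹ Y
  bottomBlock-⊤⊥ {b} {d} X Y i j = reflexive (≡.cong [ (λ i → X i j) , (λ i → Y i j) ]′ (Fin.splitAt-↑ʳ b d i))

  ∥-*ᴹ : ∀ {a b d e} (P : Mat a b) (Q : Mat a d) (T : Mat (b ℕ.+ d) e) →
         ((P ∥ Q) *ᴹ T) ≈ᴹ ((P *ᴹ topBlock T) +ᴹ (Q *ᴹ bottomBlock T))
  ∥-*ᴹ {b = b} {d} P Q T i j = trans (∑-splitAt {b} {d} (λ k → (P ∥ Q) i k * T k j))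
    (+-cong (∑-cong (λ k → *-congʳ (leftBlock-∥ P Q i k))) (∑-cong (λ k → *-congʳ (rightBlock-∥ P Q i k))))

  [_∣_] : ∀ {n m} → Mat n m → Mat n m → Mat n (2 ℕ.* m)
  [ P ∣ Q ] = P ∥ (Q ∥ ∅ᶜ)

  ⟨_⨾_⟩ : ∀ {m e} → Mat m e → Mat m e → Mat (2 ℕ.* m) e
  ⟨ X ⨾ Y ⟩ = X ⊤⊥ (Y ⊤⊥ ∅ʳ)

  [_∣_∣_] : ∀ {n m} → Mat n m → Mat n m → Mat n m → Mat n (3 ℕ.* m)
  [ P ∣ Q ∣ R ] = P ∥ (Q ∥ (R ∥ ∅ᶜ))

  ⟨_⨾_⨾_⟩ : ∀ {m e} → Mat m e → Mat m e → Mat m e → Mat (3 ℕ.* m) e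
  ⟨ X ⨾ Y ⨾ Z ⟩ = X ⊤⊥ (Y ⊤⊥ (Z ⊤⊥ ∅ʳ))

  first : ∀ {k m e} → Mat (m ℕ.+ k) e → Mat m e
  first = topBlock

  second : ∀ {k m e} → Mat (m ℕ.+ (m ℕ.+ k)) e → Mat m e
  second {m = m} T = topBlock (bottomBlock {m} T)

  third : ∀ {k m e} → Mat (m ℕ.+ (m ℕ.+ (m ℕ.+ k))) e → Mat m e
  third {m = m} T = topBlock (bottomBlock {m} (bottomBlock {m} T))

  [∣]-*ᴹ : ∀ {n m e} (P Q : Mat n m) (T : Mat (2 ℕ.* m) e) →
           ([ P ∣ Q ] *ᴹ T) ≈ᴹ ((P *ᴹ first T) +ᴹ (Q *ᴹ second T))
  [∣]-*ᴹ {m = m} P Q T i j = trans (∥-*ᴹ P (Q ∥ ∅ᶜ) T i j)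
    (+-congˡ (trans (∥-*ᴹ Q ∅ᶜ (bottomBlock {m} T) i j) (+-identityʳ _)))

  [∣∣]-*ᴹ : ∀ {n m e} (P Q R : Mat n m) (T : Mat (3 ℕ.* m) e) →
            ([ P ∣ Q ∣ R ] *ᴹ T) ≈ᴹ (((P *ᴹ first T) +ᴹ (Q *ᴹ second T)) +ᴹ (R *ᴹ third T))
  [∣∣]-*ᴹ {m = m} P Q R T i j = trans (∥-*ᴹ P (Q ∥ (R ∥ ∅ᶜ)) T i j)
    (trans (+-congˡ (trans (∥-*ᴹ Q (R ∥ ∅ᶜ) (bottomBlock {m} T) i j)
                           (+-congˡ (trans (∥-*ᴹ R ∅ᶜ (bottomBlock {m} (bottomBlock {m} T)) i j) (+-identityʳ _)))))
           (sym (+-assoc _ _ _)))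

  first-⟨⨾⟩ : ∀ {m e} (X Y : Mat m e) → first ⟨ X ⨾ Y ⟩ ≈ᴹ X
  first-⟨⨾⟩ X Y = topBlock-⊤⊥ X (Y ⊤⊥ ∅ʳ)

  second-⟨⨾⟩ : ∀ {m e} (X Y : Mat m e) → second ⟨ X ⨾ Y ⟩ ≈ᴹ Y
  second-⟨⨾⟩ X Y i j = trans (bottomBlock-⊤⊥ X (Y ⊤⊥ ∅ʳ) _ j) (topBlock-⊤⊥ Y ∅ʳ i j)

  first-⟨⨾⨾⟩ : ∀ {m e} (X Y Z : Mat m e) → first ⟨ X ⨾ Y ⨾ Z ⟩ ≈ᴹ X
  first-⟨⨾⨾⟩ X Y Z = topBlock-⊤⊥ X (Y ⊤⊥ (Z ⊤⊥ ∅ʳ))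

  second-⟨⨾⨾⟩ : ∀ {m e} (X Y Z : Mat m e) → second ⟨ X ⨾ Y ⨾ Z ⟩ ≈ᴹ Y
  second-⟨⨾⨾⟩ X Y Z i j = trans (bottomBlock-⊤⊥ X (Y ⊤⊥ (Z ⊤⊥ ∅ʳ)) _ j) (topBlock-⊤⊥ Y (Z ⊤⊥ ∅ʳ) i j)

  third-⟨⨾⨾⟩ : ∀ {m e} (X Y Z : Mat m e) → third ⟨ X ⨾ Y ⨾ Z ⟩ ≈ᴹ Z
  third-⟨⨾⨾⟩ X Y Z i j =
    trans (bottomBlock-⊤⊥ X (Y ⊤⊥ (Z ⊤⊥ ∅ʳ)) _ j) (trans (bottomBlock-⊤⊥ Y (Z ⊤⊥ ∅ʳ) _ j) (topBlock-⊤⊥ Z ∅ʳ i j))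

  [∣]-*ᴹ-⟨⨾⟩ : ∀ {n m e} (P Q : Mat n m) (X Y : Mat m e) → ([ P ∣ Q ] *ᴹ ⟨ X ⨾ Y ⟩) ≈ᴹ ((P *ᴹ X) +ᴹ (Q *ᴹ Y))
  [∣]-*ᴹ-⟨⨾⟩ P Q X Y = ≈ᴹ-trans ([∣]-*ᴹ P Q ⟨ X ⨾ Y ⟩) (+ᴹ-cong (*ᴹ-congˡ (first-⟨⨾⟩ X Y)) (*ᴹ-congˡ (second-⟨⨾⟩ X Y)))

  [∣∣]-*ᴹ-⟨⨾⨾⟩ : ∀ {n m e} (P Q R : Mat n m) (X Y Z : Mat m e) →
                 ([ P ∣ Q ∣ R ] *ᴹ ⟨ X ⨾ Y ⨾ Z ⟩) ≈ᴹ (((P *ᴹ X) +ᴹ (Q *ᴹ Y)) +ᴹ (R *ᴹ Z))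
  [∣∣]-*ᴹ-⟨⨾⨾⟩ P Q R X Y Z = ≈ᴹ-trans ([∣∣]-*ᴹ P Q R ⟨ X ⨾ Y ⨾ Z ⟩)
    (+ᴹ-cong (+ᴹ-cong (*ᴹ-congˡ (first-⟨⨾⨾⟩ X Y Z)) (*ᴹ-congˡ (second-⟨⨾⨾⟩ X Y Z))) (*ᴹ-congˡ (third-⟨⨾⨾⟩ X Y Z)))

  ⟨⨾⨾⟩-injective : ∀ {m e} {X Y Z X′ Y′ Z′ : Mat m e} → ⟨ X ⨾ Y ⨾ Z ⟩ ≈ᴹ ⟨ X′ ⨾ Y′ ⨾ Z′ ⟩ →
                   (X ≈ᴹ X′) × (Y ≈ᴹ Y′) × (Z ≈ᴹ Z′)
  ⟨⨾⨾⟩-injective {X = X} {Y} {Z} {X′} {Y′} {Z′} S≈S′ =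
      ≈ᴹ-trans (≈ᴹ-sym (first-⟨⨾⨾⟩ X Y Z))  (≈ᴹ-trans (λ i j → S≈S′ _ j) (first-⟨⨾⨾⟩ X′ Y′ Z′))
    , ≈ᴹ-trans (≈ᴹ-sym (second-⟨⨾⨾⟩ X Y Z)) (≈ᴹ-trans (λ i j → S≈S′ _ j) (second-⟨⨾⨾⟩ X′ Y′ Z′))
    , ≈ᴹ-trans (≈ᴹ-sym (third-⟨⨾⨾⟩ X Y Z))  (≈ᴹ-trans (λ i j → S≈S′ _ j) (third-⟨⨾⨾⟩ X′ Y′ Z′))

  1ᴹ-reindex : ∀ {a b} (f : Fin a → Fin b) → (∀ {i j} → f i ≡ f j → i ≡ j) → ∀ i j → 1ᴹ (f i) (f j) ≈ 1ᴹ i j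
  1ᴹ-reindex f f-inj i j with f i Fin.≟ f j | i Fin.≟ j
  ... | yes _       | yes _   = refl
  ... | no  _       | no  _   = refl
  ... | yes fi≡fj   | no  i≢j = ⊥-elim (i≢j (f-inj fi≡fj))
  ... | no  fi≢fj   | yes i≡j = ⊥-elim (fi≢fj (≡.cong f i≡j))

  second-rightInvertible : ∀ {n m} (X Y : Mat m n) → RightInvertible ⟨ X ⨾ Y ⟩ → RightInvertible Y
  second-rightInvertible {m = m} X Y (R , SR≈1) = Y⁻¹ , YY⁻¹≈1
    where
    embed : Fin m → Fin (2 ℕ.* m)
    embed i = m ↑ʳ (i ↑ˡ 0)
    Y⁻¹ : Mat _ m
    Y⁻¹ k j = R k (embed j)
    YY⁻¹≈1 : (Y *ᴹ Y⁻¹) ≈ᴹ 1ᴹ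
    YY⁻¹≈1 i j = begin
      (Y *ᴹ Y⁻¹) i j                   ≈⟨ *ᴹ-congʳ {N = R} (second-⟨⨾⟩ X Y) i (embed j) ⟨
      (second ⟨ X ⨾ Y ⟩ *ᴹ R) i (embed j) ≈⟨ SR≈1 (embed i) (embed j) ⟩
      1ᴹ (embed i) (embed j)           ≈⟨ 1ᴹ-reindex embed (λ e → Fin.↑ˡ-injective 0 _ _ (Fin.↑ʳ-injective m _ _ e)) i j ⟩
      1ᴹ i j                           ∎

  -- Dimension counting

  _⊆_ : ∀ {n} → Subset n → Subset n → Set (c ⊔ ℓ)
  S ⊆ T = ∀ v → S v → T v

  ·-congʳ : ∀ {a b} (M : Mat a b) {x y : Vect b} → x ≈ᵛ y → (M · x) ≈ᵛ (M · y)
  ·-congʳ M x≈y i = ∑-cong (λ k → *-congˡ (x≈y k))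

  ·-distrib-+ᵛ : ∀ {a b} (M : Mat a b) (x y : Vect b) → (M · (x +ᵛ y)) ≈ᵛ ((M · x) +ᵛ (M · y))
  ·-distrib-+ᵛ M x y i = trans (∑-cong (λ k → distribˡ (M i k) (x k) (y k))) (∑-distrib-+ (λ k → M i k * x k) (λ k → M i k * y k))

  Im-*ᴹ : ∀ {n d k} {X : Mat n k} (P : Mat n d) (Q : Mat d k) → X ≈ᴹ (P *ᴹ Q) → Im X ⊆ Im P
  Im-*ᴹ P Q X≈PQ v (x , v≈Xx) = Q · x , λ i → trans (v≈Xx i) (trans (·-congˡ x X≈PQ i) (·-assoc P Q x i))

  ⊕-⊆-Im : ∀ {n d} {S T : Subset n} (P : Mat n d) → S ⊆ Im P → T ⊆ Im P → (S ⊕ T) ⊆ Im P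
  ⊕-⊆-Im P S⊆P T⊆P v (s , t , s∈S , t∈T , v≈s+t) with S⊆P s s∈S | T⊆P t t∈T
  ... | x , s≈Px | y , t≈Py = x +ᵛ y , λ i → trans (v≈s+t i) (trans (+-cong (s≈Px i) (t≈Py i)) (sym (·-distrib-+ᵛ P x y i)))

  injective-factor : ∀ {n d} {E P : Mat n d} {U : Mat d d} → Injective E → E ≈ᴹ (P *ᴹ U) →
                     Σ (Mat d d) λ R → ((U *ᴹ R) ≈ᴹ 1ᴹ) × (P ≈ᴹ (E *ᴹ R))
  injective-factor {d = d} {E} {P} {U} E-inj E≈PU = R , UR≈1 , P≈ER
    where
    U-inj : Injective U
    U-inj x Ux≈0 = E-inj x (λ i → trans (·-congˡ x E≈PU i) (trans (·-assoc P U x i) (trans (·-congʳ P Ux≈0 i) (·-zeroʳ P i))))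
    R : Mat d d
    R = proj₁ (Injective⇒rightInverse U U-inj)
    UR≈1 : (U *ᴹ R) ≈ᴹ 1ᴹ
    UR≈1 = proj₂ (Injective⇒rightInverse U U-inj)
    P≈ER : P ≈ᴹ (E *ᴹ R)
    P≈ER = ≈ᴹ-trans (≈ᴹ-sym (*ᴹ-identityʳ P)) (≈ᴹ-trans (*ᴹ-congˡ (≈ᴹ-sym UR≈1))
             (≈ᴹ-trans (≈ᴹ-sym (*ᴹ-assoc P U R)) (*ᴹ-congʳ (≈ᴹ-sym E≈PU))))

  basisMatrix : ∀ {n d} {S : Subset n} → HasDim S d → Mat n d
  basisMatrix (b , _) i t = b t i

  basisMatrix-injective : ∀ {n d} {S : Subset n} (S-dim : HasDim S d) → Injective (basisMatrix S-dim)
  basisMatrix-injective (b , _ , b-indep , _) x Ex≈0 = b-indep x (λ i → trans (∑-cong (λ j → *-comm (x j) (b j i))) (Ex≈0 i))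

  basisMatrix-factor : ∀ {n d k} {S : Subset n} (S-dim : HasDim S d) (P : Mat n k) → S ⊆ Im P →
                       Σ (Mat k d) λ U → basisMatrix S-dim ≈ᴹ (P *ᴹ U)
  basisMatrix-factor (b , b∈S , _) P S⊆P = (λ k t → proj₁ (S⊆P (b t) (b∈S t)) k) , λ i t → proj₂ (S⊆P (b t) (b∈S t)) i

  full-dimension⇒injective : ∀ {n d} {S : Subset n} (P : Mat n d) → HasDim S d → S ⊆ Im P → Injective P
  full-dimension⇒injective {d = d} P S-dim S⊆P x Px≈0 k = begin
    x k              ≈⟨ *ᴹ-identityˡ (column x) k zero ⟨
    (1ᴹ · x) k       ≈⟨ ·-congˡ x (≈ᴹ-sym UR≈1) k ⟩
    ((U *ᴹ R) · x) k ≈⟨ ·-assoc U R x k ⟩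
    (U · (R · x)) k  ≈⟨ ·-congʳ U Rx≈0 k ⟩
    (U · 0ᵛ) k       ≈⟨ ·-zeroʳ U k ⟩
    0#               ∎
    where
    U : Mat d d
    U = proj₁ (basisMatrix-factor S-dim P S⊆P)
    factor : Σ (Mat d d) λ R → ((U *ᴹ R) ≈ᴹ 1ᴹ) × (P ≈ᴹ (basisMatrix S-dim *ᴹ R))
    factor = injective-factor (basisMatrix-injective S-dim) (proj₂ (basisMatrix-factor S-dim P S⊆P))
    R : Mat d d
    R = proj₁ factor
    UR≈1 : (U *ᴹ R) ≈ᴹ 1ᴹ
    UR≈1 = proj₁ (proj₂ factor)
    Rx≈0 : (R · x) ≈ᵛ 0ᵛ
    Rx≈0 = basisMatrix-injective S-dim (R · x)
             (λ i → trans (sym (·-assoc (basisMatrix S-dim) R x i)) (trans (·-congˡ x (≈ᴹ-sym (proj₂ (proj₂ factor))) i) (Px≈0 i)))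

  full-dimension⇒factor : ∀ {n d} {S : Subset n} (P P′ : Mat n d) → HasDim S d → S ⊆ Im P → S ⊆ Im P′ →
                          Σ (Mat d d) λ T → P′ ≈ᴹ (P *ᴹ T)
  full-dimension⇒factor {d = d} P P′ S-dim S⊆P S⊆P′ = U *ᴹ R′ , ≈ᴹ-trans P′≈ER′ (≈ᴹ-trans (*ᴹ-congʳ E≈PU) (*ᴹ-assoc P U R′))
    where
    U : Mat d d
    U = proj₁ (basisMatrix-factor S-dim P S⊆P)
    E≈PU : basisMatrix S-dim ≈ᴹ (P *ᴹ U)
    E≈PU = proj₂ (basisMatrix-factor S-dim P S⊆P)
    factor′ : Σ (Mat d d) λ R → ((proj₁ (basisMatrix-factor S-dim P′ S⊆P′) *ᴹ R) ≈ᴹ 1ᴹ) × (P′ ≈ᴹ (basisMatrix S-dim *ᴹ R))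
    factor′ = injective-factor (basisMatrix-injective S-dim) (proj₂ (basisMatrix-factor S-dim P′ S⊆P′))
    R′ : Mat d d
    R′ = proj₁ factor′
    P′≈ER′ : P′ ≈ᴹ (basisMatrix S-dim *ᴹ R′)
    P′≈ER′ = proj₂ (proj₂ factor′)

  full-dimension⇒rightInvertible : ∀ {n d} {X : Mat n n} (P : Mat n d) (Q : Mat d n) →
                                   HasDim (Im X) d → X ≈ᴹ (P *ᴹ Q) → RightInvertible Q
  full-dimension⇒rightInvertible {n} {d} {X} P Q X-dim X≈PQ = Xs *ᴹ R , ≈ᴹ-trans (≈ᴹ-sym (*ᴹ-assoc Q Xs R)) QXsR≈1
    where
    Xs : Mat n d
    Xs = proj₁ (basisMatrix-factor X-dim X (λ v v∈ImX → v∈ImX))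
    E≈PQXs : basisMatrix X-dim ≈ᴹ (P *ᴹ (Q *ᴹ Xs))
    E≈PQXs = ≈ᴹ-trans (proj₂ (basisMatrix-factor X-dim X (λ v v∈ImX → v∈ImX)))
               (≈ᴹ-trans (*ᴹ-congʳ X≈PQ) (*ᴹ-assoc P Q Xs))
    factor : Σ (Mat d d) λ R → (((Q *ᴹ Xs) *ᴹ R) ≈ᴹ 1ᴹ) × (P ≈ᴹ (basisMatrix X-dim *ᴹ R))
    factor = injective-factor (basisMatrix-injective X-dim) E≈PQXs
    R : Mat d d
    R = proj₁ factor
    QXsR≈1 : ((Q *ᴹ Xs) *ᴹ R) ≈ᴹ 1ᴹ
    QXsR≈1 = proj₁ (proj₂ factor)

  InSpan : ∀ {n m} → Mat n m → Mat n m → Mat n m → Set (c ⊔ ℓ)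
  InSpan {m = m} P Q B = Σ (Mat m m) λ G → Σ (Mat m m) λ H → B ≈ᴹ ((P *ᴹ G) +ᴹ (Q *ᴹ H))

  [∣]-factor⇒InSpan : ∀ {n m} (P Q P′ Q′ : Mat n m) (T : Mat (2 ℕ.* m) (2 ℕ.* m)) →
                      [ P′ ∣ Q′ ] ≈ᴹ ([ P ∣ Q ] *ᴹ T) → InSpan P Q P′ × InSpan P Q Q′
  [∣]-factor⇒InSpan {m = m} P Q P′ Q′ T P′Q′≈PQT =
      (first (leftBlock T) , second (leftBlock T) ,
        λ i j → trans (sym (leftBlock-∥ P′ (Q′ ∥ ∅ᶜ) i j)) (trans (P′Q′≈PQT i _) ([∣]-*ᴹ P Q (leftBlock T) i j)))
    , (first (leftBlock (rightBlock {b = m} T)) , second (leftBlock (rightBlock {b = m} T)) ,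
        λ i j → trans (sym (leftBlock-∥ Q′ ∅ᶜ i j)) (trans (sym (rightBlock-∥ P′ (Q′ ∥ ∅ᶜ) i _))
                  (trans (P′Q′≈PQT i _) ([∣]-*ᴹ P Q (leftBlock (rightBlock {b = m} T)) i j))))

  full-dimension⇒InSpan : ∀ {n m} {X : Mat n n} (P Q P′ Q′ : Mat n m) (Y Y′ : Mat (2 ℕ.* m) n) →
    HasDim (Im X) (2 ℕ.* m) → X ≈ᴹ ([ P ∣ Q ] *ᴹ Y) → X ≈ᴹ ([ P′ ∣ Q′ ] *ᴹ Y′) → InSpan P Q P′ × InSpan P Q Q′
  full-dimension⇒InSpan P Q P′ Q′ Y Y′ X-dim X≈PQY X≈P′Q′Y′ =
    uncurry ([∣]-factor⇒InSpan P Q P′ Q′)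
      (full-dimension⇒factor [ P ∣ Q ] [ P′ ∣ Q′ ] X-dim (Im-*ᴹ [ P ∣ Q ] Y X≈PQY) (Im-*ᴹ [ P′ ∣ Q′ ] Y′ X≈P′Q′Y′))

  module _ {n m : ℕ} (B₁ B₂ B₃ : Mat n m) where

    [∣∣]-cancel : ∀ {e} {X Y Z X′ Y′ Z′ : Mat m e} → Injective [ B₁ ∣ B₂ ∣ B₃ ] →
                  ([ B₁ ∣ B₂ ∣ B₃ ] *ᴹ ⟨ X ⨾ Y ⨾ Z ⟩) ≈ᴹ ([ B₁ ∣ B₂ ∣ B₃ ] *ᴹ ⟨ X′ ⨾ Y′ ⨾ Z′ ⟩) →
                  (X ≈ᴹ X′) × (Y ≈ᴹ Y′) × (Z ≈ᴹ Z′)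
    [∣∣]-cancel W-inj = ⟨⨾⨾⟩-injective ∘ *ᴹ-cancelˡ [ B₁ ∣ B₂ ∣ B₃ ] W-inj

    [∣∣]-*ᴹ-⟨⨾⨾0⟩ : ∀ {e} (X Y : Mat m e) → ([ B₁ ∣ B₂ ∣ B₃ ] *ᴹ ⟨ X ⨾ Y ⨾ 0ᴹ ⟩) ≈ᴹ ((B₂ *ᴹ Y) +ᴹ (B₁ *ᴹ X))
    [∣∣]-*ᴹ-⟨⨾⨾0⟩ X Y i j = trans ([∣∣]-*ᴹ-⟨⨾⨾⟩ B₁ B₂ B₃ X Y 0ᴹ i j)
      (trans (+-congˡ (*ᴹ-zeroʳ B₃ i j)) (solve 2 (λ a b → (a :+ b) :+ con (+ 0) := b :+ a) refl _ _))

    [∣∣]-*ᴹ-⟨⨾0⨾⟩ : ∀ {e} (X Z : Mat m e) → ([ B₁ ∣ B₂ ∣ B₃ ] *ᴹ ⟨ X ⨾ 0ᴹ ⨾ Z ⟩) ≈ᴹ ((B₃ *ᴹ Z) +ᴹ (B₁ *ᴹ X))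
    [∣∣]-*ᴹ-⟨⨾0⨾⟩ X Z i j = trans ([∣∣]-*ᴹ-⟨⨾⨾⟩ B₁ B₂ B₃ X 0ᴹ Z i j)
      (trans (+-congʳ (+-congˡ (*ᴹ-zeroʳ B₂ i j))) (solve 2 (λ a c → (a :+ con (+ 0)) :+ c := c :+ a) refl _ _))

    [∣∣]-*ᴹ-⟨0⨾⨾⟩ : ∀ {e} (Y Z : Mat m e) → ([ B₁ ∣ B₂ ∣ B₃ ] *ᴹ ⟨ 0ᴹ ⨾ Y ⨾ Z ⟩) ≈ᴹ ((B₃ *ᴹ Z) +ᴹ (B₂ *ᴹ Y))
    [∣∣]-*ᴹ-⟨0⨾⨾⟩ Y Z i j = trans ([∣∣]-*ᴹ-⟨⨾⨾⟩ B₁ B₂ B₃ 0ᴹ Y Z i j)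
      (trans (+-congʳ (+-congʳ (*ᴹ-zeroʳ B₁ i j))) (solve 2 (λ b c → (con (+ 0) :+ b) :+ c := c :+ b) refl _ _))

  +ᴹ-*ᴹ-zeroʳ : ∀ {n m e} (P Q : Mat n m) {G H : Mat m e} → H ≈ᴹ 0ᴹ → ((P *ᴹ G) +ᴹ (Q *ᴹ H)) ≈ᴹ (P *ᴹ G)
  +ᴹ-*ᴹ-zeroʳ P Q {G} H≈0 i j = trans (+-congˡ (trans (*ᴹ-congˡ {M = Q} H≈0 i j) (*ᴹ-zeroʳ Q i j))) (+-identityʳ _)

  -ᴹ-cong : ∀ {a b} {M M′ N N′ : Mat a b} → M ≈ᴹ M′ → N ≈ᴹ N′ → (M -ᴹ N) ≈ᴹ (M′ -ᴹ N′)
  -ᴹ-cong M≈M′ N≈N′ i j = +-cong (M≈M′ i j) (-‿cong (N≈N′ i j))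

  negᴹ-cong : ∀ {a b} {M N : Mat a b} → M ≈ᴹ N → negᴹ M ≈ᴹ negᴹ N
  negᴹ-cong M≈N i j = -‿cong (M≈N i j)

  -- Commuting extensions

  +-exchange : ∀ {x y x′ y′} → x + y ≈ x′ + y′ → x - x′ ≈ y′ - y
  +-exchange {x} {y} {x′} {y′} x+y≈x′+y′ = begin
    x - x′                  ≈⟨ solve 3 (λ x y x′ → x :- x′ := (x :+ y) :- (x′ :+ y)) refl x y x′ ⟩
    (x + y) - (x′ + y)      ≈⟨ +-congʳ x+y≈x′+y′ ⟩
    (x′ + y′) - (x′ + y)    ≈⟨ solve 3 (λ x′ y′ y → (x′ :+ y′) :- (x′ :+ y) := y′ :- y) refl x′ y′ y ⟩
    y′ - y                  ∎

  module _ {n m : ℕ} {A A′ : Mat n n} {Z Z′ : Mat (n ℕ.+ m) (n ℕ.+ m)}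
           (ZZ′≈Z′Z : Commute Z Z′) (blockA-Z : blockA Z ≈ᴹ A) (blockA-Z′ : blockA Z′ ≈ᴹ A′) where

    commutator-blocks : ⟦ A , A′ ⟧ ≈ᴹ ((blockB Z′ *ᴹ blockC Z) +ᴹ (blockB Z *ᴹ negᴹ (blockC Z′)))
    commutator-blocks a b = begin
      (A *ᴹ A′) a b - (A′ *ᴹ A) a b                               ≈⟨ +-exchange topLeft ⟩
      (blockB Z′ *ᴹ blockC Z) a b - (blockB Z *ᴹ blockC Z′) a b   ≈⟨ +-congˡ (*ᴹ-negʳ (blockB Z) (blockC Z′) a b) ⟨
      (blockB Z′ *ᴹ blockC Z) a b + (blockB Z *ᴹ negᴹ (blockC Z′)) a b ∎
      where
      topLeft : (A *ᴹ A′) a b + (blockB Z *ᴹ blockC Z′) a b ≈ (A′ *ᴹ A) a b + (blockB Z′ *ᴹ blockC Z) a b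
      topLeft = begin
        (A *ᴹ A′) a b + (blockB Z *ᴹ blockC Z′) a b                ≈⟨ +-congʳ (*ᴹ-cong blockA-Z blockA-Z′ a b) ⟨
        (blockA Z *ᴹ blockA Z′) a b + (blockB Z *ᴹ blockC Z′) a b  ≈⟨ ∑-splitAt {n} {m} (λ k → Z (a ↑ˡ m) k * Z′ k (b ↑ˡ m)) ⟨
        (Z *ᴹ Z′) (a ↑ˡ m) (b ↑ˡ m)                                ≈⟨ ZZ′≈Z′Z _ _ ⟩
        (Z′ *ᴹ Z) (a ↑ˡ m) (b ↑ˡ m)                                ≈⟨ ∑-splitAt {n} {m} (λ k → Z′ (a ↑ˡ m) k * Z k (b ↑ˡ m)) ⟩
        (blockA Z′ *ᴹ blockA Z) a b + (blockB Z′ *ᴹ blockC Z) a b  ≈⟨ +-congʳ (*ᴹ-cong blockA-Z′ blockA-Z a b) ⟩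
        (A′ *ᴹ A) a b + (blockB Z′ *ᴹ blockC Z) a b                ∎

    topRight-blocks : ((blockB Z′ *ᴹ negᴹ (blockD Z)) +ᴹ (blockB Z *ᴹ blockD Z′)) ≈ᴹ ((A′ *ᴹ blockB Z) -ᴹ (A *ᴹ blockB Z′))
    topRight-blocks a b = begin
      (blockB Z′ *ᴹ negᴹ (blockD Z)) a b + (blockB Z *ᴹ blockD Z′) a b   ≈⟨ +-congʳ (*ᴹ-negʳ (blockB Z′) (blockD Z) a b) ⟩
      - (blockB Z′ *ᴹ blockD Z) a b + (blockB Z *ᴹ blockD Z′) a b        ≈⟨ +-comm _ _ ⟩
      (blockB Z *ᴹ blockD Z′) a b - (blockB Z′ *ᴹ blockD Z) a b          ≈⟨ +-exchange topRight ⟩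
      (A′ *ᴹ blockB Z) a b - (A *ᴹ blockB Z′) a b                        ∎
      where
      topRight : (blockB Z *ᴹ blockD Z′) a b + (A *ᴹ blockB Z′) a b ≈ (blockB Z′ *ᴹ blockD Z) a b + (A′ *ᴹ blockB Z) a b
      topRight = begin
        (blockB Z *ᴹ blockD Z′) a b + (A *ᴹ blockB Z′) a b          ≈⟨ +-comm _ _ ⟩
        (A *ᴹ blockB Z′) a b + (blockB Z *ᴹ blockD Z′) a b          ≈⟨ +-congʳ (*ᴹ-congʳ {N = blockB Z′} blockA-Z a b) ⟨
        (blockA Z *ᴹ blockB Z′) a b + (blockB Z *ᴹ blockD Z′) a b   ≈⟨ ∑-splitAt {n} {m} (λ k → Z (a ↑ˡ m) k * Z′ k (n ↑ʳ b)) ⟨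
        (Z *ᴹ Z′) (a ↑ˡ m) (n ↑ʳ b)                                 ≈⟨ ZZ′≈Z′Z _ _ ⟩
        (Z′ *ᴹ Z) (a ↑ˡ m) (n ↑ʳ b)                                 ≈⟨ ∑-splitAt {n} {m} (λ k → Z′ (a ↑ˡ m) k * Z k (n ↑ʳ b)) ⟩
        (blockA Z′ *ᴹ blockB Z) a b + (blockB Z′ *ᴹ blockD Z) a b   ≈⟨ +-congʳ (*ᴹ-congʳ {N = blockB Z} blockA-Z′ a b) ⟩
        (A′ *ᴹ blockB Z) a b + (blockB Z′ *ᴹ blockD Z) a b          ≈⟨ +-comm _ _ ⟩
        (blockB Z′ *ᴹ blockD Z) a b + (A′ *ᴹ blockB Z) a b          ∎

  blocks-≈ : ∀ {n m} {Z Z′ : Mat (n ℕ.+ m) (n ℕ.+ m)} → blockA Z ≈ᴹ blockA Z′ → blockB Z ≈ᴹ blockB Z′ →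
             blockC Z ≈ᴹ blockC Z′ → blockD Z ≈ᴹ blockD Z′ → Z ≈ᴹ Z′
  blocks-≈ {n} {m} {Z} {Z′} A≈ B≈ C≈ D≈ i j with splitAt n i in i≡ | splitAt n j in j≡
  ... | inj₁ a | inj₁ b = ≡.subst₂ (λ i j → Z i j ≈ Z′ i j) (Fin.splitAt⁻¹-↑ˡ i≡) (Fin.splitAt⁻¹-↑ˡ j≡) (A≈ a b)
  ... | inj₁ a | inj₂ b = ≡.subst₂ (λ i j → Z i j ≈ Z′ i j) (Fin.splitAt⁻¹-↑ˡ i≡) (Fin.splitAt⁻¹-↑ʳ j≡) (B≈ a b)
  ... | inj₂ a | inj₁ b = ≡.subst₂ (λ i j → Z i j ≈ Z′ i j) (Fin.splitAt⁻¹-↑ʳ i≡) (Fin.splitAt⁻¹-↑ˡ j≡) (C≈ a b)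
  ... | inj₂ a | inj₂ b = ≡.subst₂ (λ i j → Z i j ≈ Z′ i j) (Fin.splitAt⁻¹-↑ʳ i≡) (Fin.splitAt⁻¹-↑ʳ j≡) (D≈ a b)

  module ExtensionBlocks {n m : ℕ} {A₁ A₂ A₃ : Mat n n} {Z₁ Z₂ Z₃ : Mat (n ℕ.+ m) (n ℕ.+ m)}
                         (ext : IsCommExt {n} {m} A₁ A₂ A₃ Z₁ Z₂ Z₃) where

    B₁ B₂ B₃ : Mat n m
    B₁ = blockB {n} {m} Z₁
    B₂ = blockB {n} {m} Z₂
    B₃ = blockB {n} {m} Z₃

    C₁ C₂ C₃ : Mat m n
    C₁ = blockC {n} {m} Z₁
    C₂ = blockC {n} {m} Z₂
    C₃ = blockC {n} {m} Z₃

    D₁ D₂ D₃ : Mat m m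
    D₁ = blockD {n} {m} Z₁
    D₂ = blockD {n} {m} Z₂
    D₃ = blockD {n} {m} Z₃

    Z₁Z₂≈Z₂Z₁ : Commute Z₁ Z₂
    Z₁Z₂≈Z₂Z₁ = proj₁ ext
    Z₁Z₃≈Z₃Z₁ : Commute Z₁ Z₃
    Z₁Z₃≈Z₃Z₁ = proj₁ (proj₂ ext)
    Z₂Z₃≈Z₃Z₂ : Commute Z₂ Z₃
    Z₂Z₃≈Z₃Z₂ = proj₁ (proj₂ (proj₂ ext))
    blockA₁ : blockA {n} {m} Z₁ ≈ᴹ A₁
    blockA₁ = proj₁ (proj₂ (proj₂ (proj₂ ext)))
    blockA₂ : blockA {n} {m} Z₂ ≈ᴹ A₂
    blockA₂ = proj₁ (proj₂ (proj₂ (proj₂ (proj₂ ext))))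
    blockA₃ : blockA {n} {m} Z₃ ≈ᴹ A₃
    blockA₃ = proj₂ (proj₂ (proj₂ (proj₂ (proj₂ ext))))

    [A₁,A₂]≈ : ⟦ A₁ , A₂ ⟧ ≈ᴹ ((B₂ *ᴹ C₁) +ᴹ (B₁ *ᴹ negᴹ C₂))
    [A₁,A₂]≈ = commutator-blocks Z₁Z₂≈Z₂Z₁ blockA₁ blockA₂

    [A₁,A₃]≈ : ⟦ A₁ , A₃ ⟧ ≈ᴹ ((B₃ *ᴹ C₁) +ᴹ (B₁ *ᴹ negᴹ C₃))
    [A₁,A₃]≈ = commutator-blocks Z₁Z₃≈Z₃Z₁ blockA₁ blockA₃

    [A₂,A₃]≈ : ⟦ A₂ , A₃ ⟧ ≈ᴹ ((B₃ *ᴹ C₂) +ᴹ (B₂ *ᴹ negᴹ C₃))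
    [A₂,A₃]≈ = commutator-blocks Z₂Z₃≈Z₃Z₂ blockA₂ blockA₃

    [A₁,A₂]-factor : ⟦ A₁ , A₂ ⟧ ≈ᴹ ([ B₂ ∣ B₁ ] *ᴹ ⟨ C₁ ⨾ negᴹ C₂ ⟩)
    [A₁,A₂]-factor = ≈ᴹ-trans [A₁,A₂]≈ (≈ᴹ-sym ([∣]-*ᴹ-⟨⨾⟩ B₂ B₁ C₁ (negᴹ C₂)))

    [A₁,A₃]-factor : ⟦ A₁ , A₃ ⟧ ≈ᴹ ([ B₃ ∣ B₁ ] *ᴹ ⟨ C₁ ⨾ negᴹ C₃ ⟩)
    [A₁,A₃]-factor = ≈ᴹ-trans [A₁,A₃]≈ (≈ᴹ-sym ([∣]-*ᴹ-⟨⨾⟩ B₃ B₁ C₁ (negᴹ C₃)))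

    [A₂,A₃]-factor : ⟦ A₂ , A₃ ⟧ ≈ᴹ ([ B₃ ∣ B₂ ] *ᴹ ⟨ C₂ ⨾ negᴹ C₃ ⟩)
    [A₂,A₃]-factor = ≈ᴹ-trans [A₂,A₃]≈ (≈ᴹ-sym ([∣]-*ᴹ-⟨⨾⟩ B₃ B₂ C₂ (negᴹ C₃)))

    topRight₁₂ : ((B₂ *ᴹ negᴹ D₁) +ᴹ (B₁ *ᴹ D₂)) ≈ᴹ ((A₂ *ᴹ B₁) -ᴹ (A₁ *ᴹ B₂))
    topRight₁₂ = topRight-blocks Z₁Z₂≈Z₂Z₁ blockA₁ blockA₂

    topRight₁₃ : ((B₃ *ᴹ negᴹ D₁) +ᴹ (B₁ *ᴹ D₃)) ≈ᴹ ((A₃ *ᴹ B₁) -ᴹ (A₁ *ᴹ B₃))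
    topRight₁₃ = topRight-blocks Z₁Z₃≈Z₃Z₁ blockA₁ blockA₃

  module ≈ᴹ-Reasoning {a b : ℕ} = Relation.Binary.Reasoning.Setoid (≈ᴹ-setoid a b)

module Uniqueness {c ℓ : Level} (F : Field c ℓ) where
  open LinAlg F
  open LinearAlgebra F
  open ≈ᴹ-Reasoning

  module TwoExtensions {n m : ℕ} {A₁ A₂ A₃ : Mat n n} {Z₁ Z₂ Z₃ Z₁′ Z₂′ Z₃′ : Mat (n ℕ.+ m) (n ℕ.+ m)}
    (ext : IsCommExt {n} {m} A₁ A₂ A₃ Z₁ Z₂ Z₃) (ext′ : IsCommExt {n} {m} A₁ A₂ A₃ Z₁′ Z₂′ Z₃′)
    (B₁≈B₁′ : blockB {n} {m} Z₁ ≈ᴹ blockB {n} {m} Z₁′)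
    (dim₁₂ : HasDim (Im ⟦ A₁ , A₂ ⟧) (2 ℕ.* m)) (dim₁₃ : HasDim (Im ⟦ A₁ , A₃ ⟧) (2 ℕ.* m))
    (dim₂₃ : HasDim (Im ⟦ A₂ , A₃ ⟧) (2 ℕ.* m)) (dim₁₂₊₁₃ : HasDim (Im ⟦ A₁ , A₂ ⟧ ⊕ Im ⟦ A₁ , A₃ ⟧) (3 ℕ.* m))
    where
    open ExtensionBlocks ext
    open ExtensionBlocks ext′ using () renaming
      ( B₁ to B₁′; B₂ to B₂′; B₃ to B₃′; C₁ to C₁′; C₂ to C₂′; C₃ to C₃′; D₁ to D₁′; D₂ to D₂′; D₃ to D₃′
      ; blockA₁ to blockA₁′; blockA₂ to blockA₂′; blockA₃ to blockA₃′
      ; [A₁,A₂]≈ to [A₁,A₂]≈′; [A₁,A₃]≈ to [A₁,A₃]≈′; [A₂,A₃]≈ to [A₂,A₃]≈′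
      ; [A₁,A₂]-factor to [A₁,A₂]-factor′; [A₁,A₃]-factor to [A₁,A₃]-factor′; [A₂,A₃]-factor to [A₂,A₃]-factor′
      ; topRight₁₂ to topRight₁₂′; topRight₁₃ to topRight₁₃′ )

    W : Mat n (3 ℕ.* m)
    W = [ B₁ ∣ B₂ ∣ B₃ ]

    W-injective : Injective W
    W-injective = full-dimension⇒injective W dim₁₂₊₁₃ (⊕-⊆-Im W
      (Im-*ᴹ W ⟨ negᴹ C₂ ⨾ C₁ ⨾ 0ᴹ ⟩ (≈ᴹ-trans [A₁,A₂]≈ (≈ᴹ-sym ([∣∣]-*ᴹ-⟨⨾⨾0⟩ B₁ B₂ B₃ (negᴹ C₂) C₁))))
      (Im-*ᴹ W ⟨ negᴹ C₃ ⨾ 0ᴹ ⨾ C₁ ⟩ (≈ᴹ-trans [A₁,A₃]≈ (≈ᴹ-sym ([∣∣]-*ᴹ-⟨⨾0⨾⟩ B₁ B₂ B₃ (negᴹ C₃) C₁)))))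

    W-cancel : ∀ {e} {X Y Z X′ Y′ Z′ : Mat m e} → (W *ᴹ ⟨ X ⨾ Y ⨾ Z ⟩) ≈ᴹ (W *ᴹ ⟨ X′ ⨾ Y′ ⨾ Z′ ⟩) →
               (X ≈ᴹ X′) × (Y ≈ᴹ Y′) × (Z ≈ᴹ Z′)
    W-cancel = [∣∣]-cancel B₁ B₂ B₃ W-injective

    -- Im [A₁,A₂] has dimension 2m, so its spanning blocks [B₂ ∣ B₁] are fixed up to a change of basis.
    span₁₂ : InSpan B₂ B₁ B₂′ × InSpan B₂ B₁ B₁′
    span₁₂ = full-dimension⇒InSpan B₂ B₁ B₂′ B₁′ _ _ dim₁₂ [A₁,A₂]-factor [A₁,A₂]-factor′

    span₁₃ : InSpan B₃ B₁ B₃′ × InSpan B₃ B₁ B₁′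
    span₁₃ = full-dimension⇒InSpan B₃ B₁ B₃′ B₁′ _ _ dim₁₃ [A₁,A₃]-factor [A₁,A₃]-factor′

    span₂₃ : InSpan B₃ B₂ B₃′ × InSpan B₃ B₂ B₂′
    span₂₃ = full-dimension⇒InSpan B₃ B₂ B₃′ B₂′ _ _ dim₂₃ [A₂,A₃]-factor [A₂,A₃]-factor′

    G₂ : Mat m m
    G₂ = proj₁ (proj₁ span₁₂)

    B₂′≈B₂G₂ : B₂′ ≈ᴹ (B₂ *ᴹ G₂)
    B₂′≈B₂G₂ = ≈ᴹ-trans B₂′≈B₂G₂+B₁H (+ᴹ-*ᴹ-zeroʳ B₂ B₁ (proj₁ (W-cancel (begin
      W *ᴹ ⟨ H ⨾ G₂ ⨾ 0ᴹ ⟩          ≈⟨ [∣∣]-*ᴹ-⟨⨾⨾0⟩ B₁ B₂ B₃ H G₂ ⟩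
      (B₂ *ᴹ G₂) +ᴹ (B₁ *ᴹ H)       ≈⟨ B₂′≈B₂G₂+B₁H ⟨
      B₂′                           ≈⟨ B₂′≈B₃G′+B₂H′ ⟩
      (B₃ *ᴹ G′) +ᴹ (B₂ *ᴹ H′)      ≈⟨ [∣∣]-*ᴹ-⟨0⨾⨾⟩ B₁ B₂ B₃ H′ G′ ⟨
      W *ᴹ ⟨ 0ᴹ ⨾ H′ ⨾ G′ ⟩         ∎))))
      where
      H G′ H′ : Mat m m
      H = proj₁ (proj₂ (proj₁ span₁₂))
      G′ = proj₁ (proj₂ span₂₃)
      H′ = proj₁ (proj₂ (proj₂ span₂₃))
      B₂′≈B₂G₂+B₁H : B₂′ ≈ᴹ ((B₂ *ᴹ G₂) +ᴹ (B₁ *ᴹ H))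
      B₂′≈B₂G₂+B₁H = proj₂ (proj₂ (proj₁ span₁₂))
      B₂′≈B₃G′+B₂H′ : B₂′ ≈ᴹ ((B₃ *ᴹ G′) +ᴹ (B₂ *ᴹ H′))
      B₂′≈B₃G′+B₂H′ = proj₂ (proj₂ (proj₂ span₂₃))

    G₃ : Mat m m
    G₃ = proj₁ (proj₁ span₁₃)

    B₃′≈B₃G₃ : B₃′ ≈ᴹ (B₃ *ᴹ G₃)
    B₃′≈B₃G₃ = ≈ᴹ-trans B₃′≈B₃G₃+B₁H (+ᴹ-*ᴹ-zeroʳ B₃ B₁ (proj₁ (W-cancel (begin
      W *ᴹ ⟨ H ⨾ 0ᴹ ⨾ G₃ ⟩          ≈⟨ [∣∣]-*ᴹ-⟨⨾0⨾⟩ B₁ B₂ B₃ H G₃ ⟩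
      (B₃ *ᴹ G₃) +ᴹ (B₁ *ᴹ H)       ≈⟨ B₃′≈B₃G₃+B₁H ⟨
      B₃′                           ≈⟨ B₃′≈B₃G′+B₂H′ ⟩
      (B₃ *ᴹ G′) +ᴹ (B₂ *ᴹ H′)      ≈⟨ [∣∣]-*ᴹ-⟨0⨾⨾⟩ B₁ B₂ B₃ H′ G′ ⟨
      W *ᴹ ⟨ 0ᴹ ⨾ H′ ⨾ G′ ⟩         ∎))))
      where
      H G′ H′ : Mat m m
      H = proj₁ (proj₂ (proj₁ span₁₃))
      G′ = proj₁ (proj₁ span₂₃)
      H′ = proj₁ (proj₂ (proj₁ span₂₃))
      B₃′≈B₃G₃+B₁H : B₃′ ≈ᴹ ((B₃ *ᴹ G₃) +ᴹ (B₁ *ᴹ H))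
      B₃′≈B₃G₃+B₁H = proj₂ (proj₂ (proj₁ span₁₃))
      B₃′≈B₃G′+B₂H′ : B₃′ ≈ᴹ ((B₃ *ᴹ G′) +ᴹ (B₂ *ᴹ H′))
      B₃′≈B₃G′+B₂H′ = proj₂ (proj₂ (proj₁ span₂₃))

    W-coordinates₁₂ : (W *ᴹ ⟨ negᴹ C₂ ⨾ C₁ ⨾ 0ᴹ ⟩) ≈ᴹ (W *ᴹ ⟨ negᴹ C₂′ ⨾ G₂ *ᴹ C₁′ ⨾ 0ᴹ ⟩)
    W-coordinates₁₂ = begin
      W *ᴹ ⟨ negᴹ C₂ ⨾ C₁ ⨾ 0ᴹ ⟩               ≈⟨ [∣∣]-*ᴹ-⟨⨾⨾0⟩ B₁ B₂ B₃ (negᴹ C₂) C₁ ⟩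
      (B₂ *ᴹ C₁) +ᴹ (B₁ *ᴹ negᴹ C₂)           ≈⟨ [A₁,A₂]≈ ⟨
      ⟦ A₁ , A₂ ⟧                             ≈⟨ [A₁,A₂]≈′ ⟩
      (B₂′ *ᴹ C₁′) +ᴹ (B₁′ *ᴹ negᴹ C₂′)       ≈⟨ +ᴹ-cong (≈ᴹ-trans (*ᴹ-congʳ B₂′≈B₂G₂) (*ᴹ-assoc B₂ G₂ C₁′)) (*ᴹ-congʳ (≈ᴹ-sym B₁≈B₁′)) ⟩
      (B₂ *ᴹ (G₂ *ᴹ C₁′)) +ᴹ (B₁ *ᴹ negᴹ C₂′) ≈⟨ [∣∣]-*ᴹ-⟨⨾⨾0⟩ B₁ B₂ B₃ (negᴹ C₂′) (G₂ *ᴹ C₁′) ⟨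
      W *ᴹ ⟨ negᴹ C₂′ ⨾ G₂ *ᴹ C₁′ ⨾ 0ᴹ ⟩       ∎

    W-coordinates₁₃ : (W *ᴹ ⟨ negᴹ C₃ ⨾ 0ᴹ ⨾ C₁ ⟩) ≈ᴹ (W *ᴹ ⟨ negᴹ C₃′ ⨾ 0ᴹ ⨾ G₃ *ᴹ C₁′ ⟩)
    W-coordinates₁₃ = begin
      W *ᴹ ⟨ negᴹ C₃ ⨾ 0ᴹ ⨾ C₁ ⟩               ≈⟨ [∣∣]-*ᴹ-⟨⨾0⨾⟩ B₁ B₂ B₃ (negᴹ C₃) C₁ ⟩
      (B₃ *ᴹ C₁) +ᴹ (B₁ *ᴹ negᴹ C₃)           ≈⟨ [A₁,A₃]≈ ⟨
      ⟦ A₁ , A₃ ⟧                             ≈⟨ [A₁,A₃]≈′ ⟩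
      (B₃′ *ᴹ C₁′) +ᴹ (B₁′ *ᴹ negᴹ C₃′)       ≈⟨ +ᴹ-cong (≈ᴹ-trans (*ᴹ-congʳ B₃′≈B₃G₃) (*ᴹ-assoc B₃ G₃ C₁′)) (*ᴹ-congʳ (≈ᴹ-sym B₁≈B₁′)) ⟩
      (B₃ *ᴹ (G₃ *ᴹ C₁′)) +ᴹ (B₁ *ᴹ negᴹ C₃′) ≈⟨ [∣∣]-*ᴹ-⟨⨾0⨾⟩ B₁ B₂ B₃ (negᴹ C₃′) (G₃ *ᴹ C₁′) ⟨
      W *ᴹ ⟨ negᴹ C₃′ ⨾ 0ᴹ ⨾ G₃ *ᴹ C₁′ ⟩       ∎

    W-coordinates₂₃ : (W *ᴹ ⟨ 0ᴹ ⨾ negᴹ C₃ ⨾ C₂ ⟩) ≈ᴹ (W *ᴹ ⟨ 0ᴹ ⨾ G₂ *ᴹ negᴹ C₃′ ⨾ G₃ *ᴹ C₂′ ⟩)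
    W-coordinates₂₃ = begin
      W *ᴹ ⟨ 0ᴹ ⨾ negᴹ C₃ ⨾ C₂ ⟩                        ≈⟨ [∣∣]-*ᴹ-⟨0⨾⨾⟩ B₁ B₂ B₃ (negᴹ C₃) C₂ ⟩
      (B₃ *ᴹ C₂) +ᴹ (B₂ *ᴹ negᴹ C₃)                    ≈⟨ [A₂,A₃]≈ ⟨
      ⟦ A₂ , A₃ ⟧                                      ≈⟨ [A₂,A₃]≈′ ⟩
      (B₃′ *ᴹ C₂′) +ᴹ (B₂′ *ᴹ negᴹ C₃′)                ≈⟨ +ᴹ-cong (≈ᴹ-trans (*ᴹ-congʳ B₃′≈B₃G₃) (*ᴹ-assoc B₃ G₃ C₂′))
                                                                  (≈ᴹ-trans (*ᴹ-congʳ B₂′≈B₂G₂) (*ᴹ-assoc B₂ G₂ (negᴹ C₃′))) ⟩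
      (B₃ *ᴹ (G₃ *ᴹ C₂′)) +ᴹ (B₂ *ᴹ (G₂ *ᴹ negᴹ C₃′))  ≈⟨ [∣∣]-*ᴹ-⟨0⨾⨾⟩ B₁ B₂ B₃ (G₂ *ᴹ negᴹ C₃′) (G₃ *ᴹ C₂′) ⟨
      W *ᴹ ⟨ 0ᴹ ⨾ G₂ *ᴹ negᴹ C₃′ ⨾ G₃ *ᴹ C₂′ ⟩          ∎

    C₂≈C₂′ : C₂ ≈ᴹ C₂′
    C₂≈C₂′ = negᴹ-injective (proj₁ (W-cancel W-coordinates₁₂))

    C₃≈C₃′ : C₃ ≈ᴹ C₃′
    C₃≈C₃′ = negᴹ-injective (proj₁ (W-cancel W-coordinates₁₃))

    G₂≈1 : G₂ ≈ᴹ 1ᴹ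
    G₂≈1 = fixes-rightInvertible⇒≈1ᴹ G₂
      (second-rightInvertible C₁ (negᴹ C₃) (full-dimension⇒rightInvertible [ B₃ ∣ B₁ ] _ dim₁₃ [A₁,A₃]-factor))
      (≈ᴹ-trans (*ᴹ-congˡ (negᴹ-cong C₃≈C₃′)) (≈ᴹ-sym (proj₁ (proj₂ (W-cancel W-coordinates₂₃)))))

    G₃≈1 : G₃ ≈ᴹ 1ᴹ
    G₃≈1 = fixes-rightInvertible⇒≈1ᴹ G₃
      (second-rightInvertible C₁ (negᴹ C₂) (full-dimension⇒rightInvertible [ B₂ ∣ B₁ ] _ dim₁₂ [A₁,A₂]-factor))
      (≈ᴹ-trans (*ᴹ-negʳ G₃ C₂) (negᴹ-cong (≈ᴹ-trans (*ᴹ-congˡ C₂≈C₂′) (≈ᴹ-sym (proj₂ (proj₂ (W-cancel W-coordinates₂₃)))))))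

    B₂≈B₂′ : B₂ ≈ᴹ B₂′
    B₂≈B₂′ = ≈ᴹ-sym (≈ᴹ-trans B₂′≈B₂G₂ (≈ᴹ-trans (*ᴹ-congˡ G₂≈1) (*ᴹ-identityʳ B₂)))

    B₃≈B₃′ : B₃ ≈ᴹ B₃′
    B₃≈B₃′ = ≈ᴹ-sym (≈ᴹ-trans B₃′≈B₃G₃ (≈ᴹ-trans (*ᴹ-congˡ G₃≈1) (*ᴹ-identityʳ B₃)))

    C₁≈C₁′ : C₁ ≈ᴹ C₁′
    C₁≈C₁′ = ≈ᴹ-trans (proj₁ (proj₂ (W-cancel W-coordinates₁₂))) (≈ᴹ-trans (*ᴹ-congʳ G₂≈1) (*ᴹ-identityˡ C₁′))

    W-coordinates-topRight₁₂ : (W *ᴹ ⟨ D₂ ⨾ negᴹ D₁ ⨾ 0ᴹ ⟩) ≈ᴹ (W *ᴹ ⟨ D₂′ ⨾ negᴹ D₁′ ⨾ 0ᴹ ⟩)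
    W-coordinates-topRight₁₂ = begin
      W *ᴹ ⟨ D₂ ⨾ negᴹ D₁ ⨾ 0ᴹ ⟩          ≈⟨ [∣∣]-*ᴹ-⟨⨾⨾0⟩ B₁ B₂ B₃ D₂ (negᴹ D₁) ⟩
      (B₂ *ᴹ negᴹ D₁) +ᴹ (B₁ *ᴹ D₂)      ≈⟨ topRight₁₂ ⟩
      (A₂ *ᴹ B₁) -ᴹ (A₁ *ᴹ B₂)           ≈⟨ -ᴹ-cong (*ᴹ-congˡ B₁≈B₁′) (*ᴹ-congˡ B₂≈B₂′) ⟩
      (A₂ *ᴹ B₁′) -ᴹ (A₁ *ᴹ B₂′)         ≈⟨ topRight₁₂′ ⟨
      (B₂′ *ᴹ negᴹ D₁′) +ᴹ (B₁′ *ᴹ D₂′)  ≈⟨ +ᴹ-cong (*ᴹ-congʳ (≈ᴹ-sym B₂≈B₂′)) (*ᴹ-congʳ (≈ᴹ-sym B₁≈B₁′)) ⟩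
      (B₂ *ᴹ negᴹ D₁′) +ᴹ (B₁ *ᴹ D₂′)    ≈⟨ [∣∣]-*ᴹ-⟨⨾⨾0⟩ B₁ B₂ B₃ D₂′ (negᴹ D₁′) ⟨
      W *ᴹ ⟨ D₂′ ⨾ negᴹ D₁′ ⨾ 0ᴹ ⟩        ∎

    W-coordinates-topRight₁₃ : (W *ᴹ ⟨ D₃ ⨾ 0ᴹ ⨾ negᴹ D₁ ⟩) ≈ᴹ (W *ᴹ ⟨ D₃′ ⨾ 0ᴹ ⨾ negᴹ D₁′ ⟩)
    W-coordinates-topRight₁₃ = begin
      W *ᴹ ⟨ D₃ ⨾ 0ᴹ ⨾ negᴹ D₁ ⟩          ≈⟨ [∣∣]-*ᴹ-⟨⨾0⨾⟩ B₁ B₂ B₃ D₃ (negᴹ D₁) ⟩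
      (B₃ *ᴹ negᴹ D₁) +ᴹ (B₁ *ᴹ D₃)      ≈⟨ topRight₁₃ ⟩
      (A₃ *ᴹ B₁) -ᴹ (A₁ *ᴹ B₃)           ≈⟨ -ᴹ-cong (*ᴹ-congˡ B₁≈B₁′) (*ᴹ-congˡ B₃≈B₃′) ⟩
      (A₃ *ᴹ B₁′) -ᴹ (A₁ *ᴹ B₃′)         ≈⟨ topRight₁₃′ ⟨
      (B₃′ *ᴹ negᴹ D₁′) +ᴹ (B₁′ *ᴹ D₃′)  ≈⟨ +ᴹ-cong (*ᴹ-congʳ (≈ᴹ-sym B₃≈B₃′)) (*ᴹ-congʳ (≈ᴹ-sym B₁≈B₁′)) ⟩
      (B₃ *ᴹ negᴹ D₁′) +ᴹ (B₁ *ᴹ D₃′)    ≈⟨ [∣∣]-*ᴹ-⟨⨾0⨾⟩ B₁ B₂ B₃ D₃′ (negᴹ D₁′) ⟨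
      W *ᴹ ⟨ D₃′ ⨾ 0ᴹ ⨾ negᴹ D₁′ ⟩        ∎

    D₁≈D₁′ : D₁ ≈ᴹ D₁′
    D₁≈D₁′ = negᴹ-injective (proj₁ (proj₂ (W-cancel W-coordinates-topRight₁₂)))

    D₂≈D₂′ : D₂ ≈ᴹ D₂′
    D₂≈D₂′ = proj₁ (W-cancel W-coordinates-topRight₁₂)

    D₃≈D₃′ : D₃ ≈ᴹ D₃′
    D₃≈D₃′ = proj₁ (W-cancel W-coordinates-topRight₁₃)

    A₁≈A₁′ : blockA {n} {m} Z₁ ≈ᴹ blockA {n} {m} Z₁′
    A₁≈A₁′ = ≈ᴹ-trans blockA₁ (≈ᴹ-sym blockA₁′)

    A₂≈A₂′ : blockA {n} {m} Z₂ ≈ᴹ blockA {n} {m} Z₂′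
    A₂≈A₂′ = ≈ᴹ-trans blockA₂ (≈ᴹ-sym blockA₂′)

    A₃≈A₃′ : blockA {n} {m} Z₃ ≈ᴹ blockA {n} {m} Z₃′
    A₃≈A₃′ = ≈ᴹ-trans blockA₃ (≈ᴹ-sym blockA₃′)

-- Imported only now: inside LinearAlgebra these names would clash with the
-- field operations.
open import Data.Nat using (_+_; _*_; _∸_; _≤_)

theorem2 : ∀ {c ℓ : Level} (F : Field c ℓ) → let open LinAlg F in
    (n r : ℕ) → n ≤ r →
    (A₁ A₂ A₃ : Mat n n) →
    HasDim (Im ⟦ A₁ , A₂ ⟧) (2 * (r ∸ n)) →
    HasDim (Im ⟦ A₁ , A₃ ⟧) (2 * (r ∸ n)) →
    HasDim (Im ⟦ A₂ , A₃ ⟧) (2 * (r ∸ n)) →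
    HasDim (Im ⟦ A₁ , A₂ ⟧ ⊕ Im ⟦ A₁ , A₃ ⟧) (3 * (r ∸ n)) →
    HasDim (Im ⟦ A₂ , A₁ ⟧ ⊕ Im ⟦ A₂ , A₃ ⟧) (3 * (r ∸ n)) →
    HasDim (Im ⟦ A₃ , A₁ ⟧ ⊕ Im ⟦ A₃ , A₂ ⟧) (3 * (r ∸ n)) →
    (Z₁ Z₂ Z₃ Z₁′ Z₂′ Z₃′ : Mat (n + (r ∸ n)) (n + (r ∸ n))) →
    IsCommExt {n} {r ∸ n} A₁ A₂ A₃ Z₁ Z₂ Z₃ →
    IsCommExt {n} {r ∸ n} A₁ A₂ A₃ Z₁′ Z₂′ Z₃′ →
    blockB {n} {r ∸ n} Z₁ ≈ᴹ blockB {n} {r ∸ n} Z₁′ →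
    (Z₁ ≈ᴹ Z₁′) × (Z₂ ≈ᴹ Z₂′) × (Z₃ ≈ᴹ Z₃′)
-- n ≤ r is implicit in the size r ∸ n, and of the three sum hypotheses only
-- the first is needed.
theorem2 F n r _ A₁ A₂ A₃ dim₁₂ dim₁₃ dim₂₃ dim₁₂₊₁₃ _ _ Z₁ Z₂ Z₃ Z₁′ Z₂′ Z₃′ ext ext′ B₁≈B₁′ =
    blocks-≈ A₁≈A₁′ B₁≈B₁′ C₁≈C₁′ D₁≈D₁′
  , blocks-≈ A₂≈A₂′ B₂≈B₂′ C₂≈C₂′ D₂≈D₂′
  , blocks-≈ A₃≈A₃′ B₃≈B₃′ C₃≈C₃′ D₃≈D₃′
  where
  open LinearAlgebra F using (blocks-≈)
  open Uniqueness.TwoExtensions F ext ext′ B₁≈B₁′ dim₁₂ dim₁₃ dim₂₃ dim₁₂₊₁₃
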